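{- Let $\mathbf{r}=(r_1,\dots,r_n)$ be a vector of positive integers. Then $$\sum_{\sigma\in\mathfrak{S}_n^{\mathbf{r}}}q^{\mathrm{maj}(\sigma)}=[n]!\cdot\prod_{i=1}^n\big(1+(r_i-1)q\big).$$
   Context: For $1\le i\le n$ let $S_i=\{ -1\}\cup\{2,3,\dots,r_i\}$ (so $S_i=\{ -1\}$ if $r_i=1$). An $\mathbf{r}$-signed permutation is a list $\sigma=(\sigma_1,\dots,\sigma_{n+1})=((j_1,\pi_1),(j_2,\pi_2),\dots,(j_n,\pi_n),0)$ where $\pi_1\pi_2\cdots\pi_n$ is a permutation in the symmetric group $\mathfrak{S}_n$ and $j_k\in S_{\pi_k}$ for each $k$; $\mathfrak{S}_n^{\mathbf{r}}$ denotes the set of these. The labels $\{(j,i):1\le i\le n,\ j\in S_i\}\cup\{0\}$ are totally ordered as follows: pairs $(j,i)$ are ordered lexicographically (first by $j$, then by $i$), and $0<(j,i)$ if and only if $0<j$. The descent set is $\mathrm{Des}(\sigma)=\{k:1\le k\le n,\ \sigma_k>\sigma_{k+1}\}$ and $\mathrm{maj}(\sigma)=\sum_{k\in\mathrm{Des}(\sigma)}k$. $[k]=1+q+\dots+q^{k-1}$, $[n]!=[n]\cdots[1]$. -}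

module Defs where

open import Data.Nat as ℕ using (ℕ; zero; suc)
open import Data.Integer as ℤ using (ℤ; +_; -[1+_])
open import Data.Fin as Fin using (Fin; toℕ)
open import Data.List using (List; []; _∷_; map; concatMap; filter; allFin; upTo; foldr; length; _++_)
open import Data.List.Relation.Unary.Unique.DecPropositional using (unique?)
import Data.Fin.Properties as FinP
open import Data.Product using (_×_; _,_)
open import Data.Bool using (Bool; true; false; _∧_; _∨_; if_then_else_)
open import Relation.Nullary.Decidable using (⌊_⌋)
open import Relation.Binary.PropositionalEquality using (_≡_)

-- Polynomials in q with natural-number coefficients, as coefficient
-- lists in ascending degree:  a₀ ∷ a₁ ∷ …  means  a₀ + a₁ q + …

Poly : Set
Poly = List ℕ

coeff : Poly → ℕ → ℕ
coeff []       _       = 0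
coeff (a ∷ _)  zero    = a
coeff (_ ∷ p)  (suc k) = coeff p k

infix 4 _≈ᵖ_
_≈ᵖ_ : Poly → Poly → Set
p ≈ᵖ p′ = ∀ k → coeff p k ≡ coeff p′ k

infixl 6 _+ᵖ_
_+ᵖ_ : Poly → Poly → Poly
[]      +ᵖ p′       = p′
(a ∷ p) +ᵖ []       = a ∷ p
(a ∷ p) +ᵖ (b ∷ p′) = (a ℕ.+ b) ∷ (p +ᵖ p′)

_·ᵖ_ : ℕ → Poly → Poly
c ·ᵖ p = map (c ℕ.*_) p

infixl 7 _*ᵖ_
_*ᵖ_ : Poly → Poly → Poly
[]      *ᵖ p′ = []
(a ∷ p) *ᵖ p′ = (a ·ᵖ p′) +ᵖ (0 ∷ (p *ᵖ p′))

1ᵖ : Poly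
1ᵖ = 1 ∷ []

qpow : ℕ → Poly
qpow zero    = 1ᵖ
qpow (suc k) = 0 ∷ qpow k

sumᵖ : List Poly → Poly
sumᵖ = foldr _+ᵖ_ []

prodᵖ : List Poly → Poly
prodᵖ = foldr _*ᵖ_ 1ᵖ

qint : ℕ → Poly
qint k = sumᵖ (map qpow (upTo k))

qfact : ℕ → Poly
qfact zero    = 1ᵖ
qfact (suc n) = qint (suc n) *ᵖ qfact n

-- r-signed permutations.
-- Indices i ∈ {1,…,n} are represented by Fin n (i = toℕ i + 1); the
-- shift by one does not affect the order on labels.

Sset : ℕ → List ℤ
Sset r = -[1+ 0 ] ∷ map (λ t → + (2 ℕ.+ t)) (upTo (r ℕ.∸ 1))

words : (n m : ℕ) → List (List (Fin n))
words n zero    = [] ∷ []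
words n (suc m) = concatMap (λ x → map (x ∷_) (words n m)) (allFin n)

perms : (n : ℕ) → List (List (Fin n))
perms n = filter (unique? FinP._≟_) (words n n)

signings : ∀ {n} → (Fin n → ℕ) → List (Fin n) → List (List (ℤ × Fin n))
signings r []      = [] ∷ []
signings r (i ∷ π) =
  concatMap (λ j → map ((j , i) ∷_) (signings r π)) (Sset (r i))

-- 𝔖ₙ^r : the list of all r-signed permutations, each given as the list
-- ((j₁,π₁),…,(jₙ,πₙ)) (the final entry 0 is implicit)
signedPerms : (n : ℕ) → (Fin n → ℕ) → List (List (ℤ × Fin n))
signedPerms n r = concatMap (signings r) (perms n)

data Label (n : ℕ) : Set where
  lzero : Label n
  lpair : ℤ → Fin n → Label n

_<ᴸ_ : ∀ {n} → Label n → Label n → Bool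
lzero     <ᴸ lzero      = false
lzero     <ᴸ lpair j i  = ⌊ + 0 ℤ.<? j ⌋
lpair j i <ᴸ lzero      = ⌊ j ℤ.≤? + 0 ⌋
lpair j i <ᴸ lpair j′ i′ =
  ⌊ j ℤ.<? j′ ⌋ ∨ (⌊ j ℤ.≟ j′ ⌋ ∧ ⌊ i Fin.<? i′ ⌋)

fullWord : ∀ {n} → List (ℤ × Fin n) → List (Label n)
fullWord σ = map (λ { (j , i) → lpair j i }) σ ++ (lzero ∷ [])

majFrom : ∀ {n} → ℕ → List (Label n) → ℕ
majFrom pos []            = 0
majFrom pos (x ∷ [])      = 0
majFrom pos (x ∷ y ∷ w)   =
  (if y <ᴸ x then pos else 0) ℕ.+ majFrom (suc pos) (y ∷ w)

maj : ∀ {n} → List (ℤ × Fin n) → ℕ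
maj σ = majFrom 1 (fullWord σ)

-- Generalise the final entry 0 to an arbitrary label c, and 𝔖ₙ to the arrangements of a list D of m distinct
-- letters.  Then  Σ q^maj(σ followed by c) = [m]! · Σ_τ q^{a(τ,c)},  where τ runs over the signings of D and
-- a(τ,c) counts the entries of τ above c.  By induction on m: the last entry x = (j,y) of σ adds a descent
-- m·[c < x], and the rest contributes [m-1]! q^{a(τ′,x)} for the signings τ′ of D ∖ y.  Regrouping (y, j, τ′)
-- as a signing τ of D with a marked entry x, the exponents m·[c < x] + a(τ ∖ x, x) are the ranks of the entries
-- of τ counted cyclically from just above c, shifted by K = a(τ,c); they sum to [m] q^K.  For c = 0 each letter
-- i contributes 1 (sign -1, below 0) or q (signs 2,…,rᵢ, above 0), whence Π (1 + (rᵢ - 1) q).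

module Submission where

open import Defs
open import Data.Nat using (ℕ; zero; suc; _≤_; _∸_)
open import Data.Fin as Fin using (Fin)
open import Data.List using (List; []; _∷_; map; _++_; length; concatMap; filter; allFin; upTo; applyUpTo)
open import Data.Integer as ℤ using (ℤ)
import Data.Integer.Properties as ℤ
import Data.Fin.Properties as Fin
open import Data.Bool using (Bool; true; false; T; not; _∧_; if_then_else_)
open import Data.Bool.Properties using (∧-identityʳ)
open import Data.Unit using (tt)
open import Data.Empty using (⊥; ⊥-elim)
open import Data.Product using (_×_; _,_; proj₁; proj₂)
open import Data.Sum using (_⊎_; inj₁; inj₂)
open import Data.List.Properties
  using (filter-all; upTo-∷ʳ; map-applyUpTo; map-++; ++-assoc; length-map; length-upTo; length-tabulate)
open import Data.List.Relation.Unary.All using (All; []; _∷_)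
import Data.List.Relation.Unary.All as All
import Data.List.Relation.Unary.All.Properties as All
open import Data.List.Relation.Unary.Any using (here; there)
open import Data.List.Relation.Unary.AllPairs using (AllPairs; []; _∷_)
import Data.List.Relation.Unary.AllPairs as AllPairs
import Data.List.Relation.Unary.AllPairs.Properties as AllPairs
open import Data.List.Relation.Unary.Unique.Propositional using (Unique)
import Data.List.Relation.Unary.Unique.Propositional.Properties as Unique
open import Data.List.Relation.Unary.Unique.DecPropositional using (unique?)
open import Data.List.Membership.Propositional using (_∈_)
open import Data.List.Membership.Propositional.Properties using (∈-filter⁺; ∈-filter⁻; ∈-map⁺; ∈-allFin)
open import Function using (_∘_; case_of_; _⇔_; mk⇔)
open import Level using (0ℓ)
open import Algebra.Bundles using (CommutativeMonoid; CommutativeSemiring)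
import Algebra.Properties.CommutativeSemigroup as CommSemigroupProperties
open import Relation.Binary.Bundles using (Setoid)
open import Relation.Binary.Structures using (IsEquivalence)
open import Relation.Binary.Definitions using (DecidableEquality; tri<; tri≈; tri>)
import Relation.Binary.Reasoning.Setoid as SetoidReasoning
open import Relation.Binary.PropositionalEquality
  using (_≡_; _≢_; refl; sym; trans; cong; cong₂; module ≡-Reasoning)
open import Relation.Nullary using (¬_; Dec; yes; no; does; ¬?; _×-dec_; contradiction)
import Relation.Nullary.Decidable as Dec
open import Relation.Nullary.Decidable using (T?; fromWitness; does-≡; dec-true)
open import Relation.Unary using (Pred; Decidable)
import Data.List.Membership.DecPropositional as DecMembership

module ListSums {c ℓ} (R : CommutativeSemiring c ℓ) where

  open CommutativeSemiring R renaming (refl to ≈-refl; sym to ≈-sym; trans to ≈-trans)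
  open CommSemigroupProperties +-commutativeSemigroup
    using (interchange; x∙yz≈y∙xz)
  open SetoidReasoning setoid

  private variable
    A B : Set

  ∑ : List A → (A → Carrier) → Carrier
  ∑ []       f = 0#
  ∑ (x ∷ xs) f = f x + ∑ xs f

  ∑-cong : ∀ {f g : A → Carrier} xs → (∀ x → f x ≈ g x) → ∑ xs f ≈ ∑ xs g
  ∑-cong []       f≈g = ≈-refl
  ∑-cong (x ∷ xs) f≈g = +-cong (f≈g x) (∑-cong xs f≈g)

  ∑-congᴬ : ∀ {P : A → Set} {f g : A → Carrier} {xs} →
            All P xs → (∀ x → P x → f x ≈ g x) → ∑ xs f ≈ ∑ xs g
  ∑-congᴬ []         f≈g = ≈-refl
  ∑-congᴬ (px ∷ pxs) f≈g = +-cong (f≈g _ px) (∑-congᴬ pxs f≈g)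

  ∑-map : ∀ (f : B → Carrier) (h : A → B) xs → ∑ (map h xs) f ≡ ∑ xs (λ x → f (h x))
  ∑-map f h []       = refl
  ∑-map f h (x ∷ xs) = cong (f (h x) +_) (∑-map f h xs)

  ∑-++ : ∀ (f : A → Carrier) xs ys → ∑ (xs ++ ys) f ≈ ∑ xs f + ∑ ys f
  ∑-++ f []       ys = ≈-sym (+-identityˡ _)
  ∑-++ f (x ∷ xs) ys = begin
    f x + ∑ (xs ++ ys) f        ≈⟨ +-cong ≈-refl (∑-++ f xs ys) ⟩
    f x + (∑ xs f + ∑ ys f)     ≈⟨ +-assoc (f x) _ _ ⟨
    f x + ∑ xs f + ∑ ys f       ∎

  ∑-concatMap : ∀ (f : B → Carrier) (g : A → List B) xs →
                ∑ (concatMap g xs) f ≈ ∑ xs (λ x → ∑ (g x) f)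
  ∑-concatMap f g []       = ≈-refl
  ∑-concatMap f g (x ∷ xs) = ≈-trans (∑-++ f (g x) (concatMap g xs)) (+-cong ≈-refl (∑-concatMap f g xs))

  ∑-zero : ∀ (xs : List A) → ∑ xs (λ _ → 0#) ≈ 0#
  ∑-zero []       = ≈-refl
  ∑-zero (x ∷ xs) = ≈-trans (+-identityˡ _) (∑-zero xs)

  ∑-+ : ∀ (f g : A → Carrier) xs → ∑ xs (λ x → f x + g x) ≈ ∑ xs f + ∑ xs g
  ∑-+ f g []       = ≈-sym (+-identityˡ 0#)
  ∑-+ f g (x ∷ xs) = ≈-trans (+-cong ≈-refl (∑-+ f g xs)) (interchange (f x) (g x) _ _)

  ∑-comm : ∀ (f : A → B → Carrier) xs ys →
           ∑ xs (λ x → ∑ ys (f x)) ≈ ∑ ys (λ y → ∑ xs (λ x → f x y))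
  ∑-comm f []       ys = ≈-sym (∑-zero ys)
  ∑-comm f (x ∷ xs) ys = begin
    ∑ ys (f x) + ∑ xs (λ x → ∑ ys (f x))           ≈⟨ +-cong ≈-refl (∑-comm f xs ys) ⟩
    ∑ ys (f x) + ∑ ys (λ y → ∑ xs (λ x → f x y))   ≈⟨ ∑-+ (f x) _ ys ⟨
    ∑ ys (λ y → f x y + ∑ xs (λ x → f x y))        ∎

  *-∑ : ∀ p (f : A → Carrier) xs → p * ∑ xs f ≈ ∑ xs (λ x → p * f x)
  *-∑ p f []       = zeroʳ p
  *-∑ p f (x ∷ xs) = ≈-trans (distribˡ p (f x) _) (+-cong ≈-refl (*-∑ p f xs))

  ∑-* : ∀ (f : A → Carrier) xs p → ∑ xs f * p ≈ ∑ xs (λ x → f x * p)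
  ∑-* f xs p = begin
    ∑ xs f * p                ≈⟨ *-comm _ p ⟩
    p * ∑ xs f                ≈⟨ *-∑ p f xs ⟩
    ∑ xs (λ x → p * f x)      ≈⟨ ∑-cong xs (λ x → *-comm p (f x)) ⟩
    ∑ xs (λ x → f x * p)      ∎

  when : Bool → Carrier → Carrier
  when b p = if b then p else 0#

  when-cong : ∀ b {p p′} → p ≈ p′ → when b p ≈ when b p′
  when-cong true  p≈p′ = p≈p′
  when-cong false p≈p′ = ≈-refl

  when-∧ : ∀ a b p → when (a ∧ b) p ≡ when a (when b p)
  when-∧ true  b p = refl
  when-∧ false b p = refl

  *-when : ∀ b p p′ → p * when b p′ ≈ when b (p * p′)
  *-when true  p p′ = ≈-refl
  *-when false p p′ = zeroʳ p

  ∑-when : ∀ b (f : A → Carrier) xs → ∑ xs (λ x → when b (f x)) ≈ when b (∑ xs f)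
  ∑-when true  f xs = ≈-refl
  ∑-when false f xs = ∑-zero xs

  ∑-filter : ∀ {p} {P : Pred A p} (P? : Decidable P) (f : A → Carrier) xs →
             ∑ (filter P? xs) f ≈ ∑ xs (λ x → when (does (P? x)) (f x))
  ∑-filter P? f []       = ≈-refl
  ∑-filter P? f (x ∷ xs) with does (P? x)
  ... | true  = +-cong ≈-refl (∑-filter P? f xs)
  ... | false = ≈-trans (∑-filter P? f xs) (≈-sym (+-identityˡ _))

  ∑-++-∷ : ∀ (f : A → Carrier) xs y zs → ∑ (xs ++ y ∷ zs) f ≈ f y + ∑ (xs ++ zs) f
  ∑-++-∷ f []       y zs = ≈-refl
  ∑-++-∷ f (x ∷ xs) y zs = ≈-trans (+-cong ≈-refl (∑-++-∷ f xs y zs)) (x∙yz≈y∙xz (f x) (f y) _)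

  -- `∑splits xs F` sums `F as x bs` over all ways of writing xs as as ++ x ∷ bs.
  ∑splits : List A → (List A → A → List A → Carrier) → Carrier
  ∑splits []       F = 0#
  ∑splits (x ∷ xs) F = F [] x xs + ∑splits xs (λ as → F (x ∷ as))

  ∑splits-cong : ∀ xs {F G : List A → A → List A → Carrier} →
                 (∀ as y bs → F as y bs ≈ G as y bs) → ∑splits xs F ≈ ∑splits xs G
  ∑splits-cong []       F≈G = ≈-refl
  ∑splits-cong (x ∷ xs) F≈G = +-cong (F≈G [] x xs) (∑splits-cong xs (λ as → F≈G (x ∷ as)))

  ∑-∑splits : ∀ (zs : List B) xs (F : B → List A → A → List A → Carrier) →
              ∑ zs (λ z → ∑splits xs (F z)) ≈ ∑splits xs (λ as y bs → ∑ zs (λ z → F z as y bs))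
  ∑-∑splits zs []       F = ∑-zero zs
  ∑-∑splits zs (x ∷ xs) F =
    ≈-trans (∑-+ (λ z → F z [] x xs) _ zs) (+-cong ≈-refl (∑-∑splits zs xs (λ z as → F z (x ∷ as))))

  ∑splits-whole : ∀ xs (Φ : A → List A → Carrier) →
                  ∑splits xs (λ as y bs → Φ y (as ++ y ∷ bs)) ≡ ∑ xs (λ y → Φ y xs)
  ∑splits-whole []       Φ = refl
  ∑splits-whole (x ∷ xs) Φ = cong (Φ x (x ∷ xs) +_) (∑splits-whole xs (λ y ys → Φ y (x ∷ ys)))

Unique-∷ʳ⁻ : ∀ {A : Set} (xs : List A) {y} → Unique (xs ++ y ∷ []) → Unique xs × All (_≢ y) xs
Unique-∷ʳ⁻ []       _               = [] , []
Unique-∷ʳ⁻ (x ∷ xs) (x∉xsy ∷ unique) with All.++⁻ xs x∉xsy | Unique-∷ʳ⁻ xs unique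
... | x∉xs , x≢y ∷ [] | unique′ , xs≢y = x∉xs ∷ unique′ , x≢y ∷ xs≢y

Unique-∷ʳ⁺ : ∀ {A : Set} {xs : List A} {y} → Unique xs → All (_≢ y) xs → Unique (xs ++ y ∷ [])
Unique-∷ʳ⁺ unique xs≢y = AllPairs.++⁺ unique ([] ∷ []) (All.map (_∷ []) xs≢y)

module Removal {A : Set} (_≟_ : DecidableEquality A) where

  open DecMembership _≟_ using (_∈?_)

  infixl 6 _∖_
  _∖_ : List A → A → List A
  xs ∖ y = filter (λ x → ¬? (x ≟ y)) xs

  ∖-unique : ∀ {xs} y → Unique xs → Unique (xs ∖ y)
  ∖-unique y = Unique.filter⁺ (λ x → ¬? (x ≟ y))

  ∈-∖⁺ : ∀ {x y xs} → x ∈ xs → x ≢ y → x ∈ xs ∖ y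
  ∈-∖⁺ = ∈-filter⁺ (λ x → ¬? (x ≟ _))

  ∈-∖⁻ : ∀ xs {x y} → x ∈ xs ∖ y → x ∈ xs × x ≢ y
  ∈-∖⁻ xs = ∈-filter⁻ (λ x → ¬? (x ≟ _)) {xs = xs}

  ∖-fresh : ∀ {y xs} → All (y ≢_) xs → xs ∖ y ≡ xs
  ∖-fresh y∉xs = filter-all (λ x → ¬? (x ≟ _)) (All.map (λ y≢x x≡y → y≢x (sym x≡y)) y∉xs)

  length-∖ : ∀ {y} xs → Unique xs → y ∈ xs → length xs ≡ suc (length (xs ∖ y))
  length-∖ {y} (x ∷ xs) (x∉xs ∷ unique) y∈xxs with x ≟ y | y∈xxs
  ... | yes refl | _          = cong (suc ∘ length) (sym (∖-fresh x∉xs))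
  ... | no x≢y   | here y≡x   = contradiction (sym y≡x) x≢y
  ... | no _     | there y∈xs = cong suc (length-∖ xs unique y∈xs)

  module _ {c ℓ} (R : CommutativeSemiring c ℓ) where
    open CommutativeSemiring R using (Carrier; _≈_; _+_; 0#; +-cong; +-identityˡ; +-identityʳ)
      renaming (refl to ≈-refl; reflexive to ≈-reflexive; sym to ≈-sym; trans to ≈-trans)
    open ListSums R

    ∑-∖ : ∀ xs → Unique xs → (Θ : A → List A → Carrier) →
          ∑ xs (λ y → Θ y (xs ∖ y)) ≈ ∑splits xs (λ as y bs → Θ y (as ++ bs))
    ∑-∖ []       _                Θ = ≈-refl
    ∑-∖ (x ∷ xs) (x∉xs ∷ unique) Θ =
      +-cong head (≈-trans (∑-congᴬ x∉xs tail) (∑-∖ xs unique (λ y ys → Θ y (x ∷ ys))))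
      where
      head : Θ x ((x ∷ xs) ∖ x) ≈ Θ x xs
      head with x ≟ x
      ... | yes _   = ≈-reflexive (cong (Θ x) (∖-fresh x∉xs))
      ... | no x≢x = contradiction refl x≢x
      tail : ∀ y → x ≢ y → Θ y ((x ∷ xs) ∖ y) ≈ Θ y (x ∷ xs ∖ y)
      tail y x≢y with x ≟ y
      ... | yes x≡y = contradiction x≡y x≢y
      ... | no _    = ≈-refl

    ∑-when-≡ : ∀ {d} us → Unique us → d ∈ us → (f : A → Carrier) →
               ∑ us (λ y → when (does (y ≟ d)) (f y)) ≈ f d
    ∑-when-≡ {d} (u ∷ us) (u∉us ∷ unique) d∈uus f with u ≟ d | d∈uus
    ... | yes refl | _          =
      ≈-trans (+-cong ≈-refl (≈-trans (∑-congᴬ u∉us vanish) (∑-zero us))) (+-identityʳ _)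
      where
      vanish : ∀ y → u ≢ y → when (does (y ≟ u)) (f y) ≈ 0#
      vanish y u≢y with y ≟ u
      ... | yes y≡u = contradiction (sym y≡u) u≢y
      ... | no _    = ≈-refl
    ... | no u≢d   | here d≡u   = contradiction (sym d≡u) u≢d
    ... | no _     | there d∈us = ≈-trans (+-identityˡ _) (∑-when-≡ us unique d∈us f)

    ∑-when-∈ : ∀ us xs → Unique us → Unique xs → All (_∈ us) xs → (f : A → Carrier) →
               ∑ us (λ y → when (does (y ∈? xs)) (f y)) ≈ ∑ xs f
    ∑-when-∈ us []       _ _                 _             f = ∑-zero us
    ∑-when-∈ us (x ∷ xs) uniqueᵘ (x∉xs ∷ uniqueˣ) (x∈us ∷ xs⊆us) f = begin
      ∑ us (λ y → when (does (y ∈? (x ∷ xs))) (f y))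
        ≈⟨ ∑-cong us split ⟩
      ∑ us (λ y → when (does (y ≟ x)) (f y) + when (does (y ∈? xs)) (f y))
        ≈⟨ ∑-+ _ _ us ⟩
      ∑ us (λ y → when (does (y ≟ x)) (f y)) + ∑ us (λ y → when (does (y ∈? xs)) (f y))
        ≈⟨ +-cong (∑-when-≡ us uniqueᵘ x∈us f) (∑-when-∈ us xs uniqueᵘ uniqueˣ xs⊆us f) ⟩
      f x + ∑ xs f ∎
      where
      open SetoidReasoning (CommutativeSemiring.setoid R)
      split : ∀ y → when (does (y ∈? (x ∷ xs))) (f y) ≈ when (does (y ≟ x)) (f y) + when (does (y ∈? xs)) (f y)
      split y with y ≟ x | y ∈? xs
      ... | yes refl | yes x∈xs = contradiction x∈xs (All.All¬⇒¬Any x∉xs)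
      ... | yes _    | no _     = ≈-sym (+-identityʳ _)
      ... | no _     | yes _    = ≈-sym (+-identityˡ _)
      ... | no _     | no _     = ≈-sym (+-identityˡ _)

-- Only opened here: in the modules above, `_+_` and `_*_` are the operations of the semiring.
open import Data.Nat using (_+_; _*_)
open import Data.Nat.Properties
  using (suc-injective; +-identityʳ; +-suc; +-comm; +-assoc; +-commutativeSemigroup;
         *-zeroʳ; *-identityˡ; *-comm; *-assoc; *-distribˡ-+; *-distribʳ-+)

-- `_≈ᵖ_` wrapped in a record, so that both polynomials can be inferred from a proof.
infix 4 _≋_
record _≋_ (p p′ : Poly) : Set where
  constructor coeffwise
  field coeff-≡ : p ≈ᵖ p′
open _≋_ public

≋-refl : ∀ {p} → p ≋ p
≋-refl = coeffwise λ _ → refl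

≋-sym : ∀ {p p′} → p ≋ p′ → p′ ≋ p
≋-sym (coeffwise e) = coeffwise λ k → sym (e k)

≋-trans : ∀ {p p′ p″} → p ≋ p′ → p′ ≋ p″ → p ≋ p″
≋-trans (coeffwise e) (coeffwise f) = coeffwise λ k → trans (e k) (f k)

≋-isEquivalence : IsEquivalence _≋_
≋-isEquivalence = record { refl = ≋-refl ; sym = ≋-sym ; trans = ≋-trans }

≋-setoid : Setoid 0ℓ 0ℓ
≋-setoid = record { isEquivalence = ≋-isEquivalence }

module ≋-Reasoning = SetoidReasoning ≋-setoid

≡⇒≋ : ∀ {p p′} → p ≡ p′ → p ≋ p′
≡⇒≋ refl = ≋-refl

∷-cong : ∀ {a b p p′} → a ≡ b → p ≋ p′ → a ∷ p ≋ b ∷ p′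
∷-cong a≡b (coeffwise e) = coeffwise λ { zero → a≡b ; (suc k) → e k }

∷-injective : ∀ {a b p p′} → a ∷ p ≋ b ∷ p′ → a ≡ b × p ≋ p′
∷-injective (coeffwise e) = e zero , coeffwise (λ k → e (suc k))

0∷[]≋[] : 0 ∷ [] ≋ []
0∷[]≋[] = coeffwise λ { zero → refl ; (suc k) → refl }

coeff-+ᵖ : ∀ p p′ k → coeff (p +ᵖ p′) k ≡ coeff p k + coeff p′ k
coeff-+ᵖ []      p′       k       = refl
coeff-+ᵖ (a ∷ p) []       k       = sym (+-identityʳ _)
coeff-+ᵖ (a ∷ p) (b ∷ p′) zero    = refl
coeff-+ᵖ (a ∷ p) (b ∷ p′) (suc k) = coeff-+ᵖ p p′ k

coeff-·ᵖ : ∀ a p k → coeff (a ·ᵖ p) k ≡ a * coeff p k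
coeff-·ᵖ a []      k       = sym (*-zeroʳ a)
coeff-·ᵖ a (b ∷ p) zero    = refl
coeff-·ᵖ a (b ∷ p) (suc k) = coeff-·ᵖ a p k

+ᵖ-cong : ∀ {p p′ s s′} → p ≋ p′ → s ≋ s′ → p +ᵖ s ≋ p′ +ᵖ s′
+ᵖ-cong {p} {p′} {s} {s′} (coeffwise e) (coeffwise f) = coeffwise λ k → begin
  coeff (p +ᵖ s) k        ≡⟨ coeff-+ᵖ p s k ⟩
  coeff p k + coeff s k   ≡⟨ cong₂ _+_ (e k) (f k) ⟩
  coeff p′ k + coeff s′ k ≡⟨ coeff-+ᵖ p′ s′ k ⟨
  coeff (p′ +ᵖ s′) k      ∎
  where open ≡-Reasoning

+ᵖ-comm : ∀ p s → p +ᵖ s ≋ s +ᵖ p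
+ᵖ-comm p s = coeffwise λ k → begin
  coeff (p +ᵖ s) k       ≡⟨ coeff-+ᵖ p s k ⟩
  coeff p k + coeff s k  ≡⟨ +-comm (coeff p k) _ ⟩
  coeff s k + coeff p k  ≡⟨ coeff-+ᵖ s p k ⟨
  coeff (s +ᵖ p) k       ∎
  where open ≡-Reasoning

+ᵖ-assoc : ∀ p s t → (p +ᵖ s) +ᵖ t ≋ p +ᵖ (s +ᵖ t)
+ᵖ-assoc p s t = coeffwise λ k → begin
  coeff ((p +ᵖ s) +ᵖ t) k                 ≡⟨ coeff-+ᵖ (p +ᵖ s) t k ⟩
  coeff (p +ᵖ s) k + coeff t k            ≡⟨ cong (_+ coeff t k) (coeff-+ᵖ p s k) ⟩
  coeff p k + coeff s k + coeff t k       ≡⟨ +-assoc (coeff p k) _ _ ⟩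
  coeff p k + (coeff s k + coeff t k)     ≡⟨ cong (coeff p k +_) (coeff-+ᵖ s t k) ⟨
  coeff p k + coeff (s +ᵖ t) k            ≡⟨ coeff-+ᵖ p (s +ᵖ t) k ⟨
  coeff (p +ᵖ (s +ᵖ t)) k                 ∎
  where open ≡-Reasoning

+ᵖ-identityʳ : ∀ p → p +ᵖ [] ≋ p
+ᵖ-identityʳ p = coeffwise λ k → trans (coeff-+ᵖ p [] k) (+-identityʳ _)

·ᵖ-cong : ∀ a {p p′} → p ≋ p′ → a ·ᵖ p ≋ a ·ᵖ p′
·ᵖ-cong a {p} {p′} (coeffwise e) = coeffwise λ k → begin
  coeff (a ·ᵖ p) k    ≡⟨ coeff-·ᵖ a p k ⟩
  a * coeff p k       ≡⟨ cong (a *_) (e k) ⟩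
  a * coeff p′ k      ≡⟨ coeff-·ᵖ a p′ k ⟨
  coeff (a ·ᵖ p′) k   ∎
  where open ≡-Reasoning

·ᵖ-distribˡ : ∀ a p s → a ·ᵖ (p +ᵖ s) ≋ a ·ᵖ p +ᵖ a ·ᵖ s
·ᵖ-distribˡ a p s = coeffwise λ k → begin
  coeff (a ·ᵖ (p +ᵖ s)) k                     ≡⟨ coeff-·ᵖ a (p +ᵖ s) k ⟩
  a * coeff (p +ᵖ s) k                        ≡⟨ cong (a *_) (coeff-+ᵖ p s k) ⟩
  a * (coeff p k + coeff s k)                 ≡⟨ *-distribˡ-+ a (coeff p k) _ ⟩
  a * coeff p k + a * coeff s k               ≡⟨ cong₂ _+_ (coeff-·ᵖ a p k) (coeff-·ᵖ a s k) ⟨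
  coeff (a ·ᵖ p) k + coeff (a ·ᵖ s) k         ≡⟨ coeff-+ᵖ (a ·ᵖ p) _ k ⟨
  coeff (a ·ᵖ p +ᵖ a ·ᵖ s) k                  ∎
  where open ≡-Reasoning

·ᵖ-distribʳ : ∀ a b p → (a + b) ·ᵖ p ≋ a ·ᵖ p +ᵖ b ·ᵖ p
·ᵖ-distribʳ a b p = coeffwise λ k → begin
  coeff ((a + b) ·ᵖ p) k                      ≡⟨ coeff-·ᵖ (a + b) p k ⟩
  (a + b) * coeff p k                         ≡⟨ *-distribʳ-+ (coeff p k) a b ⟩
  a * coeff p k + b * coeff p k               ≡⟨ cong₂ _+_ (coeff-·ᵖ a p k) (coeff-·ᵖ b p k) ⟨
  coeff (a ·ᵖ p) k + coeff (b ·ᵖ p) k         ≡⟨ coeff-+ᵖ (a ·ᵖ p) _ k ⟨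
  coeff (a ·ᵖ p +ᵖ b ·ᵖ p) k                  ∎
  where open ≡-Reasoning

·ᵖ-assoc : ∀ a b p → a ·ᵖ (b ·ᵖ p) ≋ (a * b) ·ᵖ p
·ᵖ-assoc a b p = coeffwise λ k → begin
  coeff (a ·ᵖ (b ·ᵖ p)) k   ≡⟨ coeff-·ᵖ a (b ·ᵖ p) k ⟩
  a * coeff (b ·ᵖ p) k      ≡⟨ cong (a *_) (coeff-·ᵖ b p k) ⟩
  a * (b * coeff p k)       ≡⟨ *-assoc a b _ ⟨
  a * b * coeff p k         ≡⟨ coeff-·ᵖ (a * b) p k ⟨
  coeff ((a * b) ·ᵖ p) k    ∎
  where open ≡-Reasoning

0·ᵖ : ∀ p → 0 ·ᵖ p ≋ []
0·ᵖ p = coeffwise (coeff-·ᵖ 0 p)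

1·ᵖ : ∀ p → 1 ·ᵖ p ≋ p
1·ᵖ p = coeffwise λ k → trans (coeff-·ᵖ 1 p k) (*-identityˡ _)

+ᵖ-commutativeMonoid : CommutativeMonoid 0ℓ 0ℓ
+ᵖ-commutativeMonoid = record
  { Carrier = Poly
  ; _≈_ = _≋_
  ; _∙_ = _+ᵖ_
  ; ε = []
  ; isCommutativeMonoid = record
    { isMonoid = record
      { isSemigroup = record
        { isMagma = record { isEquivalence = ≋-isEquivalence ; ∙-cong = +ᵖ-cong }
        ; assoc = +ᵖ-assoc }
      ; identity = (λ _ → ≋-refl) , +ᵖ-identityʳ }
    ; comm = +ᵖ-comm }
  }

open CommSemigroupProperties
  (CommutativeMonoid.commutativeSemigroup +ᵖ-commutativeMonoid)
  using () renaming (interchange to +ᵖ-interchange; x∙yz≈y∙xz to +ᵖ-exchange)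

≋[]⇒*ᵖ≋[] : ∀ {p} s → p ≋ [] → p *ᵖ s ≋ []
≋[]⇒*ᵖ≋[] {[]}    s _ = ≋-refl
≋[]⇒*ᵖ≋[] {a ∷ p} s e with ∷-injective (≋-trans e (≋-sym 0∷[]≋[]))
... | refl , p≋[] = +ᵖ-cong (0·ᵖ s) (≋-trans (∷-cong refl (≋[]⇒*ᵖ≋[] s p≋[])) 0∷[]≋[])

*ᵖ-congˡ : ∀ {p p′} s → p ≋ p′ → p *ᵖ s ≋ p′ *ᵖ s
*ᵖ-congˡ {[]}    {p′}     s e = ≋-sym (≋[]⇒*ᵖ≋[] s (≋-sym e))
*ᵖ-congˡ {a ∷ p} {[]}     s e = ≋[]⇒*ᵖ≋[] s e
*ᵖ-congˡ {a ∷ p} {b ∷ p′} s e with ∷-injective e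
... | refl , p≋p′ = +ᵖ-cong ≋-refl (∷-cong refl (*ᵖ-congˡ s p≋p′))

*ᵖ-congʳ : ∀ p {s s′} → s ≋ s′ → p *ᵖ s ≋ p *ᵖ s′
*ᵖ-congʳ []      e = ≋-refl
*ᵖ-congʳ (a ∷ p) e = +ᵖ-cong (·ᵖ-cong a e) (∷-cong refl (*ᵖ-congʳ p e))

*ᵖ-cong : ∀ {p p′ s s′} → p ≋ p′ → s ≋ s′ → p *ᵖ s ≋ p′ *ᵖ s′
*ᵖ-cong {p′ = p′} {s} e f = ≋-trans (*ᵖ-congˡ s e) (*ᵖ-congʳ p′ f)

*ᵖ-zeroʳ : ∀ p → p *ᵖ [] ≋ []
*ᵖ-zeroʳ []      = ≋-refl
*ᵖ-zeroʳ (a ∷ p) = ≋-trans (∷-cong refl (*ᵖ-zeroʳ p)) 0∷[]≋[]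

0∷-*ᵖ : ∀ p s → (0 ∷ p) *ᵖ s ≋ 0 ∷ (p *ᵖ s)
0∷-*ᵖ p s = +ᵖ-cong (0·ᵖ s) ≋-refl

*ᵖ-∷ʳ : ∀ p b s → p *ᵖ (b ∷ s) ≋ b ·ᵖ p +ᵖ (0 ∷ p *ᵖ s)
*ᵖ-∷ʳ []      b s = ≋-sym 0∷[]≋[]
*ᵖ-∷ʳ (a ∷ p) b s = ∷-cong (cong (_+ 0) (*-comm a b)) (begin
  a ·ᵖ s +ᵖ p *ᵖ (b ∷ s)                 ≈⟨ +ᵖ-cong ≋-refl (*ᵖ-∷ʳ p b s) ⟩
  a ·ᵖ s +ᵖ (b ·ᵖ p +ᵖ (0 ∷ p *ᵖ s))     ≈⟨ +ᵖ-exchange (a ·ᵖ s) (b ·ᵖ p) _ ⟩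
  b ·ᵖ p +ᵖ (a ·ᵖ s +ᵖ (0 ∷ p *ᵖ s))     ∎)
  where open ≋-Reasoning

*ᵖ-comm : ∀ p s → p *ᵖ s ≋ s *ᵖ p
*ᵖ-comm p []      = *ᵖ-zeroʳ p
*ᵖ-comm p (b ∷ s) = ≋-trans (*ᵖ-∷ʳ p b s) (+ᵖ-cong ≋-refl (∷-cong refl (*ᵖ-comm p s)))

*ᵖ-distribʳ : ∀ t p s → (p +ᵖ s) *ᵖ t ≋ p *ᵖ t +ᵖ s *ᵖ t
*ᵖ-distribʳ t []      s       = ≋-refl
*ᵖ-distribʳ t (a ∷ p) []      = ≋-sym (+ᵖ-identityʳ _)
*ᵖ-distribʳ t (a ∷ p) (b ∷ s) = begin
  (a + b) ·ᵖ t +ᵖ (0 ∷ (p +ᵖ s) *ᵖ t)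
    ≈⟨ +ᵖ-cong (·ᵖ-distribʳ a b t) (∷-cong refl (*ᵖ-distribʳ t p s)) ⟩
  (a ·ᵖ t +ᵖ b ·ᵖ t) +ᵖ ((0 ∷ p *ᵖ t) +ᵖ (0 ∷ s *ᵖ t))
    ≈⟨ +ᵖ-interchange (a ·ᵖ t) (b ·ᵖ t) _ _ ⟩
  (a ·ᵖ t +ᵖ (0 ∷ p *ᵖ t)) +ᵖ (b ·ᵖ t +ᵖ (0 ∷ s *ᵖ t)) ∎
  where open ≋-Reasoning

*ᵖ-distribˡ : ∀ t p s → t *ᵖ (p +ᵖ s) ≋ t *ᵖ p +ᵖ t *ᵖ s
*ᵖ-distribˡ t p s = begin
  t *ᵖ (p +ᵖ s)        ≈⟨ *ᵖ-comm t _ ⟩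
  (p +ᵖ s) *ᵖ t        ≈⟨ *ᵖ-distribʳ t p s ⟩
  p *ᵖ t +ᵖ s *ᵖ t     ≈⟨ +ᵖ-cong (*ᵖ-comm p t) (*ᵖ-comm s t) ⟩
  t *ᵖ p +ᵖ t *ᵖ s     ∎
  where open ≋-Reasoning

·ᵖ-*ᵖ : ∀ a p s → (a ·ᵖ p) *ᵖ s ≋ a ·ᵖ (p *ᵖ s)
·ᵖ-*ᵖ a []      s = ≋-refl
·ᵖ-*ᵖ a (b ∷ p) s = begin
  (a * b) ·ᵖ s +ᵖ (0 ∷ (a ·ᵖ p) *ᵖ s)
    ≈⟨ +ᵖ-cong (≋-sym (·ᵖ-assoc a b s)) (∷-cong (sym (*-zeroʳ a)) (·ᵖ-*ᵖ a p s)) ⟩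
  a ·ᵖ (b ·ᵖ s) +ᵖ a ·ᵖ (0 ∷ p *ᵖ s)
    ≈⟨ ·ᵖ-distribˡ a (b ·ᵖ s) _ ⟨
  a ·ᵖ (b ·ᵖ s +ᵖ (0 ∷ p *ᵖ s)) ∎
  where open ≋-Reasoning

*ᵖ-assoc : ∀ p s t → (p *ᵖ s) *ᵖ t ≋ p *ᵖ (s *ᵖ t)
*ᵖ-assoc []      s t = ≋-refl
*ᵖ-assoc (a ∷ p) s t = begin
  (a ·ᵖ s +ᵖ (0 ∷ p *ᵖ s)) *ᵖ t                ≈⟨ *ᵖ-distribʳ t (a ·ᵖ s) _ ⟩
  (a ·ᵖ s) *ᵖ t +ᵖ (0 ∷ p *ᵖ s) *ᵖ t           ≈⟨ +ᵖ-cong (·ᵖ-*ᵖ a s t) (0∷-*ᵖ (p *ᵖ s) t) ⟩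
  a ·ᵖ (s *ᵖ t) +ᵖ (0 ∷ (p *ᵖ s) *ᵖ t)         ≈⟨ +ᵖ-cong ≋-refl (∷-cong refl (*ᵖ-assoc p s t)) ⟩
  a ·ᵖ (s *ᵖ t) +ᵖ (0 ∷ p *ᵖ (s *ᵖ t))         ∎
  where open ≋-Reasoning

*ᵖ-identityˡ : ∀ p → 1ᵖ *ᵖ p ≋ p
*ᵖ-identityˡ p = ≋-trans (+ᵖ-cong (1·ᵖ p) 0∷[]≋[]) (+ᵖ-identityʳ p)

*ᵖ-identityʳ : ∀ p → p *ᵖ 1ᵖ ≋ p
*ᵖ-identityʳ p = ≋-trans (*ᵖ-comm p 1ᵖ) (*ᵖ-identityˡ p)

Poly-commutativeSemiring : CommutativeSemiring 0ℓ 0ℓ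
Poly-commutativeSemiring = record
  { Carrier = Poly
  ; _≈_ = _≋_
  ; _+_ = _+ᵖ_
  ; _*_ = _*ᵖ_
  ; 0# = []
  ; 1# = 1ᵖ
  ; isCommutativeSemiring = record
    { isSemiring = record
      { isSemiringWithoutAnnihilatingZero = record
        { +-isCommutativeMonoid = CommutativeMonoid.isCommutativeMonoid +ᵖ-commutativeMonoid
        ; *-cong = *ᵖ-cong
        ; *-assoc = *ᵖ-assoc
        ; *-identity = *ᵖ-identityˡ , *ᵖ-identityʳ
        ; distrib = *ᵖ-distribˡ , *ᵖ-distribʳ }
      ; zero = (λ _ → ≋-refl) , *ᵖ-zeroʳ }
    ; *-comm = *ᵖ-comm }
  }

open CommSemigroupProperties (CommutativeSemiring.*-commutativeSemigroup Poly-commutativeSemiring)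
  using () renaming (x∙yz≈y∙xz to *ᵖ-exchange)

qpow-+ : ∀ a b → qpow (a + b) ≋ qpow a *ᵖ qpow b
qpow-+ zero    b = ≋-sym (*ᵖ-identityˡ (qpow b))
qpow-+ (suc a) b = ≋-trans (∷-cong refl (qpow-+ a b)) (≋-sym (0∷-*ᵖ (qpow a) (qpow b)))

open ListSums Poly-commutativeSemiring

sumᵖ-map : ∀ {A : Set} (f : A → Poly) xs → sumᵖ (map f xs) ≡ ∑ xs f
sumᵖ-map f []       = refl
sumᵖ-map f (x ∷ xs) = cong (f x +ᵖ_) (sumᵖ-map f xs)

qint-suc : ∀ k → qint (suc k) ≋ qint k +ᵖ qpow k
qint-suc k = begin
  qint (suc k)                          ≡⟨ sumᵖ-map qpow (upTo (suc k)) ⟩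
  ∑ (upTo (suc k)) qpow                 ≡⟨ cong (λ is → ∑ is qpow) (upTo-∷ʳ k) ⟨
  ∑ (upTo k ++ k ∷ []) qpow             ≈⟨ ∑-++ qpow (upTo k) (k ∷ []) ⟩
  ∑ (upTo k) qpow +ᵖ (qpow k +ᵖ [])     ≡⟨ cong (_+ᵖ (qpow k +ᵖ [])) (sumᵖ-map qpow (upTo k)) ⟨
  qint k +ᵖ (qpow k +ᵖ [])              ≈⟨ +ᵖ-cong ≋-refl (+ᵖ-identityʳ (qpow k)) ⟩
  qint k +ᵖ qpow k                      ∎
  where open ≋-Reasoning

qint-suc′ : ∀ k → qint (suc k) ≋ 1ᵖ +ᵖ qpow 1 *ᵖ qint k
qint-suc′ k = +ᵖ-cong ≋-refl (begin
  sumᵖ (map qpow (applyUpTo suc k))     ≡⟨ sumᵖ-map qpow (applyUpTo suc k) ⟩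
  ∑ (applyUpTo suc k) qpow              ≡⟨ cong (λ is → ∑ is qpow) (map-applyUpTo (λ i → i) suc k) ⟨
  ∑ (map suc (upTo k)) qpow             ≡⟨ ∑-map qpow suc (upTo k) ⟩
  ∑ (upTo k) (λ i → qpow (suc i))       ≈⟨ ∑-cong (upTo k) (qpow-+ 1) ⟩
  ∑ (upTo k) (λ i → qpow 1 *ᵖ qpow i)   ≈⟨ *-∑ (qpow 1) qpow (upTo k) ⟨
  qpow 1 *ᵖ ∑ (upTo k) qpow             ≡⟨ cong (qpow 1 *ᵖ_) (sumᵖ-map qpow (upTo k)) ⟨
  qpow 1 *ᵖ qint k                      ∎)
  where open ≋-Reasoning

qint-suc-*-qpow-suc : ∀ k K →
  qint (suc k) *ᵖ qpow (suc K) ≋ qpow (suc (k + K)) +ᵖ qpow 1 *ᵖ (qint k *ᵖ qpow K)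
qint-suc-*-qpow-suc k K = begin
  qint (suc k) *ᵖ qpow (suc K)
    ≈⟨ *ᵖ-congˡ (qpow (suc K)) (qint-suc k) ⟩
  (qint k +ᵖ qpow k) *ᵖ qpow (suc K)
    ≈⟨ *ᵖ-distribʳ (qpow (suc K)) (qint k) (qpow k) ⟩
  qint k *ᵖ qpow (suc K) +ᵖ qpow k *ᵖ qpow (suc K)
    ≈⟨ +ᵖ-comm (qint k *ᵖ qpow (suc K)) _ ⟩
  qpow k *ᵖ qpow (suc K) +ᵖ qint k *ᵖ qpow (suc K)
    ≈⟨ +ᵖ-cong (qpow-+ k (suc K)) ≋-refl ⟨
  qpow (k + suc K) +ᵖ qint k *ᵖ qpow (suc K)
    ≡⟨ cong (λ e → qpow e +ᵖ qint k *ᵖ qpow (suc K)) (+-suc k K) ⟩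
  qpow (suc (k + K)) +ᵖ qint k *ᵖ qpow (1 + K)
    ≈⟨ +ᵖ-cong ≋-refl (*ᵖ-congʳ (qint k) (qpow-+ 1 K)) ⟩
  qpow (suc (k + K)) +ᵖ qint k *ᵖ (qpow 1 *ᵖ qpow K)
    ≈⟨ +ᵖ-cong ≋-refl (*ᵖ-exchange (qint k) (qpow 1) (qpow K)) ⟩
  qpow (suc (k + K)) +ᵖ qpow 1 *ᵖ (qint k *ᵖ qpow K) ∎
  where open ≋-Reasoning

∑-const-q : ∀ {A : Set} (xs : List A) → ∑ xs (λ _ → qpow 1) ≋ 0 ∷ length xs ∷ []
∑-const-q []       = coeffwise λ { zero → refl ; (suc zero) → refl ; (suc (suc k)) → refl }
∑-const-q (x ∷ xs) = +ᵖ-cong ≋-refl (∑-const-q xs)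

onlyIf : Bool → ℕ → ℕ
onlyIf b k = if b then k else 0

onlyIf-true : ∀ {b} k → T b → onlyIf b k ≡ k
onlyIf-true {true} k _ = refl

onlyIf-false : ∀ {b} k → ¬ T b → onlyIf b k ≡ 0
onlyIf-false {true}  k ¬b = ⊥-elim (¬b tt)
onlyIf-false {false} k _  = refl

Bool-ext : ∀ {a b} → (T a → T b) → (T b → T a) → a ≡ b
Bool-ext {true}  {true}  _ _ = refl
Bool-ext {true}  {false} a⇒b _ = ⊥-elim (a⇒b tt)
Bool-ext {false} {true}  _ b⇒a = ⊥-elim (b⇒a tt)
Bool-ext {false} {false} _ _ = refl

≡-not : ∀ {a b} → (T a → ¬ T b) → (¬ T a → T b) → b ≡ not a
≡-not {true}  {true}  a⇒¬b _ = ⊥-elim (a⇒¬b tt tt)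
≡-not {true}  {false} _ _ = refl
≡-not {false} {true}  _ _ = refl
≡-not {false} {false} _ ¬a⇒b = ⊥-elim (¬a⇒b (λ ()))

All-++-∷⁻ : ∀ {A : Set} {P : A → Set} xs {y zs} → All P (xs ++ y ∷ zs) → P y × All P (xs ++ zs)
All-++-∷⁻ xs p with All.++⁻ xs p
... | pxs , py ∷ pzs = py , All.++⁺ pxs pzs

AllPairs-++-∷⁻ : ∀ {A : Set} {R : A → A → Set} → (∀ {x y} → R x y → R y x) →
                 ∀ xs {y zs} → AllPairs R (xs ++ y ∷ zs) → All (R y) (xs ++ zs) × AllPairs R (xs ++ zs)
AllPairs-++-∷⁻ sym-R []       (ry ∷ p) = ry , p
AllPairs-++-∷⁻ sym-R (x ∷ xs) (rx ∷ p) with All-++-∷⁻ xs rx | AllPairs-++-∷⁻ sym-R xs p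
... | rxy , rx′ | ry , p′ = sym-R rxy ∷ ry , rx′ ∷ p′

length-++-∷ : ∀ {A : Set} (xs : List A) y zs → length (xs ++ y ∷ zs) ≡ suc (length (xs ++ zs))
length-++-∷ []       y zs = refl
length-++-∷ (x ∷ xs) y zs = cong suc (length-++-∷ xs y zs)

module Rank {A : Set} (_<ᵇ_ : A → A → Bool)
            (<-irrefl : ∀ x → ¬ T (x <ᵇ x))
            (<-trans : ∀ {x y z} → T (x <ᵇ y) → T (y <ᵇ z) → T (x <ᵇ z)) where

  _<_ : A → A → Set
  x < y = T (x <ᵇ y)

  <-asym : ∀ {x y} → x < y → ¬ y < x
  <-asym {x} x<y y<x = <-irrefl x (<-trans x<y y<x)

  infix 4 _#_
  _#_ : A → A → Set
  x # y = x < y ⊎ y < x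

  #-sym : ∀ {x y} → x # y → y # x
  #-sym (inj₁ x<y) = inj₂ x<y
  #-sym (inj₂ y<x) = inj₁ y<x

  countAbove : List A → A → ℕ
  countAbove []       x = 0
  countAbove (u ∷ us) x = onlyIf (x <ᵇ u) 1 + countAbove us x

  countAbove-++-∷ : ∀ xs y zs x → countAbove (xs ++ y ∷ zs) x ≡ onlyIf (x <ᵇ y) 1 + countAbove (xs ++ zs) x
  countAbove-++-∷ []       y zs x = refl
  countAbove-++-∷ (u ∷ us) y zs x = begin
    onlyIf (x <ᵇ u) 1 + countAbove (us ++ y ∷ zs) x
      ≡⟨ cong (onlyIf (x <ᵇ u) 1 +_) (countAbove-++-∷ us y zs x) ⟩
    onlyIf (x <ᵇ u) 1 + (onlyIf (x <ᵇ y) 1 + countAbove (us ++ zs) x)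
      ≡⟨ x∙yz≈y∙xz (onlyIf (x <ᵇ u) 1) (onlyIf (x <ᵇ y) 1) _ ⟩
    onlyIf (x <ᵇ y) 1 + (onlyIf (x <ᵇ u) 1 + countAbove (us ++ zs) x) ∎
    where open ≡-Reasoning
          open CommSemigroupProperties +-commutativeSemigroup using (x∙yz≈y∙xz)

  countAbove-remove-self : ∀ xs z ys → countAbove (xs ++ z ∷ ys) z ≡ countAbove (xs ++ ys) z
  countAbove-remove-self xs z ys =
    trans (countAbove-++-∷ xs z ys z) (cong (_+ countAbove (xs ++ ys) z) (onlyIf-false 1 (<-irrefl z)))

  countAbove-cong : ∀ {x y} us → All (λ u → (x < u → y < u) × (y < u → x < u)) us →
                    countAbove us x ≡ countAbove us y
  countAbove-cong [] [] = refl
  countAbove-cong {x} {y} (u ∷ us) ((x<u⇒y<u , y<u⇒x<u) ∷ ps) =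
    cong₂ _+_ (cong (λ b → onlyIf b 1) (Bool-ext x<u⇒y<u y<u⇒x<u)) (countAbove-cong us ps)

  countAbove-none : ∀ {x} us → All (λ u → ¬ x < u) us → countAbove us x ≡ 0
  countAbove-none []       []          = refl
  countAbove-none (u ∷ us) (¬x<u ∷ ps) = cong₂ _+_ (onlyIf-false 1 ¬x<u) (countAbove-none us ps)

  data MinAbove (c : A) : List A → Set where
    minAbove : ∀ xs z ys → c < z → All (λ x → c < x → z < x) (xs ++ ys) → MinAbove c (xs ++ z ∷ ys)

  data Maximum : List A → Set where
    maximum : ∀ xs z ys → All (_< z) (xs ++ ys) → Maximum (xs ++ z ∷ ys)

  minAbove-or-none : ∀ c X → AllPairs _#_ X → MinAbove c X ⊎ All (λ x → ¬ c < x) X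
  minAbove-or-none c []       _          = inj₂ []
  minAbove-or-none c (x ∷ X) (x#X ∷ pairs) with minAbove-or-none c X pairs | T? (c <ᵇ x)
  ... | inj₂ none | yes c<x = inj₁ (minAbove [] x X c<x (All.map (λ ¬c<u c<u → ⊥-elim (¬c<u c<u)) none))
  ... | inj₂ none | no ¬c<x = inj₂ (¬c<x ∷ none)
  ... | inj₁ (minAbove xs z ys c<z zMin) | no ¬c<x =
    inj₁ (minAbove (x ∷ xs) z ys c<z ((λ c<x → ⊥-elim (¬c<x c<x)) ∷ zMin))
  ... | inj₁ (minAbove xs z ys c<z zMin) | yes c<x with All-++-∷⁻ xs x#X
  ...   | inj₂ z<x , _ = inj₁ (minAbove (x ∷ xs) z ys c<z ((λ _ → z<x) ∷ zMin))
  ...   | inj₁ x<z , _ with All.++⁻ xs zMin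
  ...     | zMinˣˢ , zMinʸˢ =
    inj₁ (minAbove [] x (xs ++ z ∷ ys) c<x (All.++⁺ (above zMinˣˢ) ((λ _ → x<z) ∷ above zMinʸˢ)))
    where
    above : ∀ {us} → All (λ u → c < u → z < u) us → All (λ u → c < u → x < u) us
    above = All.map (λ z<u c<u → <-trans x<z (z<u c<u))

  maximum-or-empty : ∀ X → AllPairs _#_ X → Maximum X ⊎ X ≡ []
  maximum-or-empty []      _             = inj₂ refl
  maximum-or-empty (x ∷ X) (x#X ∷ pairs) with maximum-or-empty X pairs
  ... | inj₂ refl = inj₁ (maximum [] x [] [])
  ... | inj₁ (maximum xs z ys zMax) with All-++-∷⁻ xs x#X
  ...   | inj₁ x<z , _ = inj₁ (maximum (x ∷ xs) z ys (x<z ∷ zMax))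
  ...   | inj₂ z<x , _ with All.++⁻ xs zMax
  ...     | zMaxˣˢ , zMaxʸˢ = inj₁ (maximum [] x (xs ++ z ∷ ys) (All.++⁺ (below zMaxˣˢ) (z<x ∷ below zMaxʸˢ)))
    where
    below : ∀ {us} → All (_< z) us → All (_< x) us
    below = All.map (λ u<z → <-trans u<z z<x)

  rankTerm : ℕ → List A → A → A → Poly
  rankTerm k X c x = qpow (onlyIf (c <ᵇ x) k + countAbove X x)

  rankTerm-remove : ∀ k xs z ys c x → (x <ᵇ z) ≡ not (c <ᵇ x) →
    rankTerm (suc k) (xs ++ z ∷ ys) c x ≋ qpow 1 *ᵖ rankTerm k (xs ++ ys) c x
  rankTerm-remove k xs z ys c x x<z≡c≮x = ≋-trans (≡⇒≋ (cong qpow (begin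
    onlyIf (c <ᵇ x) (suc k) + countAbove (xs ++ z ∷ ys) x
      ≡⟨ cong (onlyIf (c <ᵇ x) (suc k) +_) (countAbove-++-∷ xs z ys x) ⟩
    onlyIf (c <ᵇ x) (suc k) + (onlyIf (x <ᵇ z) 1 + countAbove X′ x)
      ≡⟨ cong (λ b → onlyIf (c <ᵇ x) (suc k) + (onlyIf b 1 + countAbove X′ x)) x<z≡c≮x ⟩
    onlyIf (c <ᵇ x) (suc k) + (onlyIf (not (c <ᵇ x)) 1 + countAbove X′ x)
      ≡⟨ exponent (c <ᵇ x) ⟩
    suc (onlyIf (c <ᵇ x) k + countAbove X′ x) ∎))) (qpow-+ 1 _)
    where
    open ≡-Reasoning
    X′ = xs ++ ys
    exponent : ∀ b → onlyIf b (suc k) + (onlyIf (not b) 1 + countAbove X′ x) ≡ suc (onlyIf b k + countAbove X′ x)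
    exponent true  = refl
    exponent false = refl

  -- The hypothesis says that z comes right after c in the cyclic order; removing z then multiplies every other
  -- term by q.
  ∑-rankTerm-remove : ∀ k xs z ys c → All (λ x → (x <ᵇ z) ≡ not (c <ᵇ x)) (xs ++ ys) →
    ∑ (xs ++ z ∷ ys) (rankTerm (suc k) (xs ++ z ∷ ys) c)
      ≋ rankTerm (suc k) (xs ++ z ∷ ys) c z +ᵖ qpow 1 *ᵖ ∑ (xs ++ ys) (rankTerm k (xs ++ ys) c)
  ∑-rankTerm-remove k xs z ys c cyclic = begin
    ∑ X (rankTerm (suc k) X c)                                 ≈⟨ ∑-++-∷ _ xs z ys ⟩
    rankTerm (suc k) X c z +ᵖ ∑ X′ (rankTerm (suc k) X c)      ≈⟨ +ᵖ-cong ≋-refl (∑-congᴬ cyclic (rankTerm-remove k xs z ys c)) ⟩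
    rankTerm (suc k) X c z +ᵖ ∑ X′ (λ x → qpow 1 *ᵖ rankTerm k X′ c x)
                                                               ≈⟨ +ᵖ-cong ≋-refl (*-∑ (qpow 1) _ X′) ⟨
    rankTerm (suc k) X c z +ᵖ qpow 1 *ᵖ ∑ X′ (rankTerm k X′ c) ∎
    where
    open ≋-Reasoning
    X = xs ++ z ∷ ys
    X′ = xs ++ ys

  RankFormula : ℕ → A → List A → Set
  RankFormula k c X = ∑ X (rankTerm k X c) ≋ qint k *ᵖ qpow (countAbove X c)

  rank-minAbove : ∀ k c xs z ys → c < z → All (λ x → c < x → z < x) (xs ++ ys) → All (_# c) (xs ++ ys) →
                  RankFormula k c (xs ++ ys) → RankFormula (suc k) c (xs ++ z ∷ ys)
  rank-minAbove k c xs z ys c<z zMin X′#c IH = begin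
    ∑ X (rankTerm (suc k) X c)
      ≈⟨ ∑-rankTerm-remove k xs z ys c (All.zipWith cyclic (X′#c , zMin)) ⟩
    rankTerm (suc k) X c z +ᵖ qpow 1 *ᵖ ∑ X′ (rankTerm k X′ c)
      ≈⟨ +ᵖ-cong (≡⇒≋ (cong qpow zExponent)) (*ᵖ-congʳ (qpow 1) IH) ⟩
    qpow (suc (k + K′)) +ᵖ qpow 1 *ᵖ (qint k *ᵖ qpow K′)
      ≈⟨ qint-suc-*-qpow-suc k K′ ⟨
    qint (suc k) *ᵖ qpow (suc K′)
      ≡⟨ cong (λ e → qint (suc k) *ᵖ qpow e) cAbove ⟨
    qint (suc k) *ᵖ qpow (countAbove X c) ∎
    where
    open ≋-Reasoning
    X = xs ++ z ∷ ys
    X′ = xs ++ ys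
    K′ = countAbove X′ c
    cyclic : ∀ {x} → x # c × (c < x → z < x) → (x <ᵇ z) ≡ not (c <ᵇ x)
    cyclic (x#c , zMinₓ) = ≡-not (λ c<x → <-asym (zMinₓ c<x)) λ ¬c<x → case x#c of λ
      { (inj₁ x<c) → <-trans x<c c<z ; (inj₂ c<x) → ⊥-elim (¬c<x c<x) }
    zExponent : onlyIf (c <ᵇ z) (suc k) + countAbove X z ≡ suc (k + K′)
    zExponent = cong₂ _+_ (onlyIf-true (suc k) c<z) (trans (countAbove-remove-self xs z ys)
      (countAbove-cong X′ (All.map (λ zMinᵤ → (λ z<u → <-trans c<z z<u) , zMinᵤ) zMin)))
    cAbove : countAbove X c ≡ suc K′
    cAbove = trans (countAbove-++-∷ xs z ys c) (cong (_+ K′) (onlyIf-true 1 c<z))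

  rank-maximum : ∀ k c xs z ys → All (_< z) (xs ++ ys) → All (λ x → ¬ c < x) (xs ++ z ∷ ys) →
                 RankFormula k c (xs ++ ys) → RankFormula (suc k) c (xs ++ z ∷ ys)
  rank-maximum k c xs z ys zMax none IH = begin
    ∑ X (rankTerm (suc k) X c)
      ≈⟨ ∑-rankTerm-remove k xs z ys c (All.zipWith cyclic (none′ , zMax)) ⟩
    rankTerm (suc k) X c z +ᵖ qpow 1 *ᵖ ∑ X′ (rankTerm k X′ c)
      ≈⟨ +ᵖ-cong (≡⇒≋ (cong qpow zExponent)) (*ᵖ-congʳ (qpow 1) IH) ⟩
    1ᵖ +ᵖ qpow 1 *ᵖ (qint k *ᵖ qpow (countAbove X′ c))
      ≡⟨ cong (λ e → 1ᵖ +ᵖ qpow 1 *ᵖ (qint k *ᵖ qpow e)) (countAbove-none X′ none′) ⟩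
    1ᵖ +ᵖ qpow 1 *ᵖ (qint k *ᵖ 1ᵖ)
      ≈⟨ +ᵖ-cong (≋-refl {1ᵖ}) (*ᵖ-congʳ (qpow 1) (*ᵖ-identityʳ (qint k))) ⟩
    1ᵖ +ᵖ qpow 1 *ᵖ qint k
      ≈⟨ qint-suc′ k ⟨
    qint (suc k)
      ≈⟨ *ᵖ-identityʳ (qint (suc k)) ⟨
    qint (suc k) *ᵖ qpow 0
      ≡⟨ cong (λ e → qint (suc k) *ᵖ qpow e) (countAbove-none X none) ⟨
    qint (suc k) *ᵖ qpow (countAbove X c) ∎
    where
    open ≋-Reasoning
    X = xs ++ z ∷ ys
    X′ = xs ++ ys
    none′ = proj₂ (All-++-∷⁻ xs none)
    cyclic : ∀ {x} → ¬ c < x × x < z → (x <ᵇ z) ≡ not (c <ᵇ x)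
    cyclic (¬c<x , x<z) = ≡-not (λ c<x → ⊥-elim (¬c<x c<x)) (λ _ → x<z)
    zExponent : onlyIf (c <ᵇ z) (suc k) + countAbove X z ≡ 0
    zExponent = cong₂ _+_ (onlyIf-false (suc k) (proj₁ (All-++-∷⁻ xs none)))
      (trans (countAbove-remove-self xs z ys) (countAbove-none X′ (All.map <-asym zMax)))

  rank : ∀ k X c → length X ≡ k → AllPairs _#_ X → All (_# c) X → RankFormula k c X
  rank-without : ∀ k xs z ys c → length (xs ++ z ∷ ys) ≡ suc k → AllPairs _#_ (xs ++ z ∷ ys) →
                 All (_# c) (xs ++ z ∷ ys) → RankFormula k c (xs ++ ys)

  rank zero    []  c _   _     _   = ≋-refl
  rank (suc k) X c |X| pairs X#c with minAbove-or-none c X pairs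
  ... | inj₁ (minAbove xs z ys c<z zMin) =
    rank-minAbove k c xs z ys c<z zMin (proj₂ (All-++-∷⁻ xs X#c)) (rank-without k xs z ys c |X| pairs X#c)
  ... | inj₂ none with maximum-or-empty X pairs
  ...   | inj₂ refl = case |X| of λ ()
  ...   | inj₁ (maximum xs z ys zMax) =
    rank-maximum k c xs z ys zMax none (rank-without k xs z ys c |X| pairs X#c)

  rank-without k xs z ys c |X| pairs X#c =
    rank k (xs ++ ys) c (suc-injective (trans (sym (length-++-∷ xs z ys)) |X|))
         (proj₂ (AllPairs-++-∷⁻ #-sym xs pairs)) (proj₂ (All-++-∷⁻ xs X#c))

LabelLt : ∀ {n} → Label n → Label n → Set
LabelLt lzero       lzero         = ⊥
LabelLt lzero       (lpair j i)   = ℤ.+ 0 ℤ.< j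
LabelLt (lpair j i) lzero         = j ℤ.≤ ℤ.+ 0
LabelLt (lpair j i) (lpair j′ i′) = j ℤ.< j′ ⊎ (j ≡ j′ × i Fin.< i′)

T-<ᴸ⇒LabelLt : ∀ {n} (x y : Label n) → T (x <ᴸ y) → LabelLt x y
T-<ᴸ⇒LabelLt lzero       (lpair j i)   t with ℤ.+ 0 ℤ.<? j
... | yes 0<j = 0<j
T-<ᴸ⇒LabelLt (lpair j i) lzero         t with j ℤ.≤? ℤ.+ 0
... | yes j≤0 = j≤0
T-<ᴸ⇒LabelLt (lpair j i) (lpair j′ i′) t with j ℤ.<? j′ | j ℤ.≟ j′ | i Fin.<? i′
... | yes j<j′ | _        | _        = inj₁ j<j′
... | no _     | yes j≡j′ | yes i<i′ = inj₂ (j≡j′ , i<i′)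

LabelLt⇒T-<ᴸ : ∀ {n} (x y : Label n) → LabelLt x y → T (x <ᴸ y)
LabelLt⇒T-<ᴸ lzero       (lpair j i)   0<j = fromWitness 0<j
LabelLt⇒T-<ᴸ (lpair j i) lzero         j≤0 = fromWitness j≤0
LabelLt⇒T-<ᴸ (lpair j i) (lpair j′ i′) lt with j ℤ.<? j′ | j ℤ.≟ j′ | i Fin.<? i′ | lt
... | yes _ | _     | _     | _                  = tt
... | no _  | yes _ | yes _ | _                  = tt
... | no ¬j<j′ | _  | _     | inj₁ j<j′          = ⊥-elim (¬j<j′ j<j′)
... | no _  | no j≢j′ | _   | inj₂ (j≡j′ , _)    = ⊥-elim (j≢j′ j≡j′)
... | no _  | yes _ | no ¬i<i′ | inj₂ (_ , i<i′) = ⊥-elim (¬i<i′ i<i′)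

LabelLt-irrefl : ∀ {n} (x : Label n) → ¬ LabelLt x x
LabelLt-irrefl (lpair j i) (inj₁ j<j)       = ℤ.<-irrefl refl j<j
LabelLt-irrefl (lpair j i) (inj₂ (_ , i<i)) = Fin.<-irrefl refl i<i

LabelLt-trans : ∀ {n} (x y z : Label n) → LabelLt x y → LabelLt y z → LabelLt x z
LabelLt-trans lzero (lpair j i) lzero 0<j j≤0 = ℤ.<-irrefl refl (ℤ.<-≤-trans 0<j j≤0)
LabelLt-trans lzero (lpair j i) (lpair j′ i′) 0<j (inj₁ j<j′) = ℤ.<-trans 0<j j<j′
LabelLt-trans lzero (lpair j i) (lpair j′ i′) 0<j (inj₂ (refl , _)) = 0<j
LabelLt-trans (lpair j i) lzero (lpair j′ i′) j≤0 0<j′ = inj₁ (ℤ.≤-<-trans j≤0 0<j′)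
LabelLt-trans (lpair j i) (lpair j′ i′) lzero (inj₁ j<j′) j′≤0 = ℤ.<⇒≤ (ℤ.<-≤-trans j<j′ j′≤0)
LabelLt-trans (lpair j i) (lpair j′ i′) lzero (inj₂ (refl , _)) j′≤0 = j′≤0
LabelLt-trans (lpair j i) (lpair j′ i′) (lpair j″ i″) (inj₁ j<j′) (inj₁ j′<j″) = inj₁ (ℤ.<-trans j<j′ j′<j″)
LabelLt-trans (lpair j i) (lpair j′ i′) (lpair j″ i″) (inj₁ j<j′) (inj₂ (refl , _)) = inj₁ j<j′
LabelLt-trans (lpair j i) (lpair j′ i′) (lpair j″ i″) (inj₂ (refl , _)) (inj₁ j′<j″) = inj₁ j′<j″
LabelLt-trans (lpair j i) (lpair j′ i′) (lpair j″ i″) (inj₂ (refl , i<i′)) (inj₂ (refl , i′<i″)) =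
  inj₂ (refl , Fin.<-trans i<i′ i′<i″)

<ᴸ-irrefl : ∀ {n} (x : Label n) → ¬ T (x <ᴸ x)
<ᴸ-irrefl x x<x = LabelLt-irrefl x (T-<ᴸ⇒LabelLt x x x<x)

<ᴸ-trans : ∀ {n} {x y z : Label n} → T (x <ᴸ y) → T (y <ᴸ z) → T (x <ᴸ z)
<ᴸ-trans {x = x} {y} {z} x<y y<z =
  LabelLt⇒T-<ᴸ x z (LabelLt-trans x y z (T-<ᴸ⇒LabelLt x y x<y) (T-<ᴸ⇒LabelLt y z y<z))

module LabelRank {n : ℕ} = Rank (_<ᴸ_ {n}) <ᴸ-irrefl (λ {x} {y} {z} → <ᴸ-trans {x = x} {y} {z})
open LabelRank public

lpair-comparable : ∀ {n} j j′ {i i′ : Fin n} → i ≢ i′ → lpair j i # lpair j′ i′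
lpair-comparable j j′ {i} {i′} i≢i′ with ℤ.<-cmp j j′
... | tri< j<j′ _ _ = inj₁ (LabelLt⇒T-<ᴸ (lpair j i) (lpair j′ i′) (inj₁ j<j′))
... | tri> _ _ j′<j = inj₂ (LabelLt⇒T-<ᴸ (lpair j′ i′) (lpair j i) (inj₁ j′<j))
... | tri≈ _ refl _ with Fin.<-cmp i i′
...   | tri< i<i′ _ _ = inj₁ (LabelLt⇒T-<ᴸ (lpair j i) (lpair j′ i′) (inj₂ (refl , i<i′)))
...   | tri≈ _ i≡i′ _ = ⊥-elim (i≢i′ i≡i′)
...   | tri> _ _ i′<i = inj₂ (LabelLt⇒T-<ᴸ (lpair j′ i′) (lpair j i) (inj₂ (refl , i′<i)))

lpair-comparable-lzero : ∀ {n} j (i : Fin n) → lpair j i # lzero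
lpair-comparable-lzero j i with ℤ.<-cmp (ℤ.+ 0) j
... | tri< 0<j _ _ = inj₂ (LabelLt⇒T-<ᴸ lzero (lpair j i) 0<j)
... | tri≈ _ 0≡j _ = inj₁ (LabelLt⇒T-<ᴸ (lpair j i) lzero (ℤ.≤-reflexive (sym 0≡j)))
... | tri> _ _ j<0 = inj₁ (LabelLt⇒T-<ᴸ (lpair j i) lzero (ℤ.<⇒≤ j<0))

majFrom-++-∷ : ∀ {n} p (w : List (Label n)) x v →
               majFrom p (w ++ x ∷ v) ≡ majFrom p (w ++ x ∷ []) + majFrom (p + length w) (x ∷ v)
majFrom-++-∷ p []          x v = cong (λ q → majFrom q (x ∷ v)) (sym (+-identityʳ p))
majFrom-++-∷ p (u ∷ [])    x v =
  cong₂ _+_ (sym (+-identityʳ (onlyIf (x <ᴸ u) p))) (cong (λ q → majFrom q (x ∷ v)) (+-comm 1 p))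
majFrom-++-∷ p (u ∷ y ∷ w) x v = begin
  onlyIf (y <ᴸ u) p + majFrom (suc p) (y ∷ w ++ x ∷ v)
    ≡⟨ cong (onlyIf (y <ᴸ u) p +_) (majFrom-++-∷ (suc p) (y ∷ w) x v) ⟩
  onlyIf (y <ᴸ u) p + (majFrom (suc p) (y ∷ w ++ x ∷ []) + majFrom (suc p + length (y ∷ w)) (x ∷ v))
    ≡⟨ +-assoc (onlyIf (y <ᴸ u) p) _ _ ⟨
  onlyIf (y <ᴸ u) p + majFrom (suc p) (y ∷ w ++ x ∷ []) + majFrom (suc p + length (y ∷ w)) (x ∷ v)
    ≡⟨ cong (λ q → majFrom p (u ∷ y ∷ w ++ x ∷ []) + majFrom q (x ∷ v)) (+-suc p (length (y ∷ w))) ⟨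
  majFrom p (u ∷ y ∷ w ++ x ∷ []) + majFrom (p + length (u ∷ y ∷ w)) (x ∷ v) ∎
  where open ≡-Reasoning

∑-words-suc : ∀ n m (f : List (Fin n) → Poly) →
              ∑ (words n (suc m)) f ≋ ∑ (allFin n) (λ x → ∑ (words n m) (λ w → f (x ∷ w)))
∑-words-suc n m f = ≋-trans (∑-concatMap f (λ x → map (x ∷_) (words n m)) (allFin n))
                            (∑-cong (allFin n) (λ x → ≡⇒≋ (∑-map f (x ∷_) (words n m))))

∑-words-∷ʳ : ∀ n m (f : List (Fin n) → Poly) →
             ∑ (words n (suc m)) f ≋ ∑ (words n m) (λ v → ∑ (allFin n) (λ y → f (v ++ y ∷ [])))
∑-words-∷ʳ n zero    f = ≋-trans (∑-words-suc n zero f)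
  (≋-trans (∑-cong (allFin n) (λ y → +ᵖ-identityʳ (f (y ∷ [])))) (≋-sym (+ᵖ-identityʳ _)))
∑-words-∷ʳ n (suc m) f = begin
  ∑ (words n (suc (suc m))) f
    ≈⟨ ∑-words-suc n (suc m) f ⟩
  ∑ (allFin n) (λ x → ∑ (words n (suc m)) (λ w → f (x ∷ w)))
    ≈⟨ ∑-cong (allFin n) (λ x → ∑-words-∷ʳ n m (λ w → f (x ∷ w))) ⟩
  ∑ (allFin n) (λ x → ∑ (words n m) (λ v → ∑ (allFin n) (λ y → f (x ∷ v ++ y ∷ []))))
    ≈⟨ ∑-words-suc n m (λ v → ∑ (allFin n) (λ y → f (v ++ y ∷ []))) ⟨
  ∑ (words n (suc m)) (λ v → ∑ (allFin n) (λ y → f (v ++ y ∷ []))) ∎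
  where open ≋-Reasoning

length-words : ∀ n m → All (λ w → length w ≡ m) (words n m)
length-words n zero    = refl ∷ []
length-words n (suc m) =
  All.concat⁺ (All.map⁺ (All.universal (λ x → All.map⁺ (All.map (cong suc) (length-words n m))) (allFin n)))

module SignedPermutations (n : ℕ) (r : Fin n → ℕ) where

  open Removal (Fin._≟_ {n})
  open DecMembership (Fin._≟_ {n}) using (_∈?_)

  label : ℤ × Fin n → Label n
  label (j , i) = lpair j i

  labels : List (ℤ × Fin n) → List (Label n)
  labels = map label

  ∑-signings-∷ : ∀ i π (f : List (ℤ × Fin n) → Poly) →
    ∑ (signings r (i ∷ π)) f ≋ ∑ (Sset (r i)) (λ j → ∑ (signings r π) (λ τ → f ((j , i) ∷ τ)))
  ∑-signings-∷ i π f = ≋-trans (∑-concatMap f (λ j → map ((j , i) ∷_) (signings r π)) (Sset (r i)))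
                               (∑-cong (Sset (r i)) (λ j → ≡⇒≋ (∑-map f ((j , i) ∷_) (signings r π))))

  ∑-signings-++ : ∀ π ρ (f : List (ℤ × Fin n) → Poly) →
    ∑ (signings r (π ++ ρ)) f ≋ ∑ (signings r π) (λ τ → ∑ (signings r ρ) (λ υ → f (τ ++ υ)))
  ∑-signings-++ []      ρ f = ≋-sym (+ᵖ-identityʳ _)
  ∑-signings-++ (i ∷ π) ρ f = begin
    ∑ (signings r (i ∷ π ++ ρ)) f
      ≈⟨ ∑-signings-∷ i (π ++ ρ) f ⟩
    ∑ (Sset (r i)) (λ j → ∑ (signings r (π ++ ρ)) (λ τ → f ((j , i) ∷ τ)))
      ≈⟨ ∑-cong (Sset (r i)) (λ j → ∑-signings-++ π ρ (λ τ → f ((j , i) ∷ τ))) ⟩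
    ∑ (Sset (r i)) (λ j → ∑ (signings r π) (λ τ → ∑ (signings r ρ) (λ υ → f ((j , i) ∷ τ ++ υ))))
      ≈⟨ ∑-signings-∷ i π (λ τ → ∑ (signings r ρ) (λ υ → f (τ ++ υ))) ⟨
    ∑ (signings r (i ∷ π)) (λ τ → ∑ (signings r ρ) (λ υ → f (τ ++ υ))) ∎
    where open ≋-Reasoning

  ∑-signings-∷ʳ : ∀ π y (f : List (ℤ × Fin n) → Poly) →
    ∑ (signings r (π ++ y ∷ [])) f ≋ ∑ (signings r π) (λ τ → ∑ (Sset (r y)) (λ j → f (τ ++ (j , y) ∷ [])))
  ∑-signings-∷ʳ π y f = ≋-trans (∑-signings-++ π (y ∷ []) f) (∑-cong (signings r π) λ τ →
    ≋-trans (∑-signings-∷ y [] (λ υ → f (τ ++ υ))) (∑-cong (Sset (r y)) (λ j → +ᵖ-identityʳ _)))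

  signings-letters : ∀ π → All (λ τ → map proj₂ τ ≡ π) (signings r π)
  signings-letters []      = refl ∷ []
  signings-letters (i ∷ π) = All.concat⁺ (All.map⁺ (All.universal
    (λ j → All.map⁺ (All.map (cong (i ∷_)) (signings-letters π))) (Sset (r i))))

  majFollowedBy : List (ℤ × Fin n) → Label n → ℕ
  majFollowedBy τ c = majFrom 1 (labels τ ++ c ∷ [])

  majFollowedBy-∷ʳ : ∀ τ x c →
    majFollowedBy (τ ++ x ∷ []) c ≡ onlyIf (c <ᴸ label x) (suc (length τ)) + majFollowedBy τ (label x)
  majFollowedBy-∷ʳ τ x c = begin
    majFrom 1 (labels (τ ++ x ∷ []) ++ c ∷ [])
      ≡⟨ cong (λ w → majFrom 1 (w ++ c ∷ [])) (map-++ label τ (x ∷ [])) ⟩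
    majFrom 1 ((labels τ ++ label x ∷ []) ++ c ∷ [])
      ≡⟨ cong (majFrom 1) (++-assoc (labels τ) (label x ∷ []) (c ∷ [])) ⟩
    majFrom 1 (labels τ ++ label x ∷ c ∷ [])
      ≡⟨ majFrom-++-∷ 1 (labels τ) (label x) (c ∷ []) ⟩
    majFollowedBy τ (label x) + (onlyIf (c <ᴸ label x) (suc (length (labels τ))) + 0)
      ≡⟨ cong (λ k → majFollowedBy τ (label x) + k) (+-identityʳ _) ⟩
    majFollowedBy τ (label x) + onlyIf (c <ᴸ label x) (suc (length (labels τ)))
      ≡⟨ cong (λ k → majFollowedBy τ (label x) + onlyIf (c <ᴸ label x) (suc k)) (length-map label τ) ⟩
    majFollowedBy τ (label x) + onlyIf (c <ᴸ label x) (suc (length τ))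
      ≡⟨ +-comm (majFollowedBy τ (label x)) _ ⟩
    onlyIf (c <ᴸ label x) (suc (length τ)) + majFollowedBy τ (label x) ∎
    where open ≡-Reasoning

  -- For words of length m = length D, these are exactly the permutations of D.
  DistinctIn : List (Fin n) → List (Fin n) → Set
  DistinctIn D w = Unique w × All (_∈ D) w

  distinctIn? : ∀ D w → Dec (DistinctIn D w)
  distinctIn? D w = unique? Fin._≟_ w ×-dec All.all? (_∈? D) w

  DistinctIn-∷ʳ : ∀ D v y → (y ∈ D × DistinctIn (D ∖ y) v) ⇔ DistinctIn D (v ++ y ∷ [])
  DistinctIn-∷ʳ D v y = mk⇔
    (λ (y∈D , unique , v⊆D∖y) →
       Unique-∷ʳ⁺ unique (All.map (proj₂ ∘ ∈-∖⁻ D) v⊆D∖y) , All.++⁺ (All.map (proj₁ ∘ ∈-∖⁻ D) v⊆D∖y) (y∈D ∷ []))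
    (λ (unique , vy⊆D) → case All.++⁻ v vy⊆D of λ
       { (v⊆D , y∈D ∷ []) → y∈D , proj₁ (Unique-∷ʳ⁻ v unique) ,
           All.zipWith (λ (x∈D , x≢y) → ∈-∖⁺ x∈D x≢y) (v⊆D , proj₂ (Unique-∷ʳ⁻ v unique)) })

  distinctIn?-∷ʳ : ∀ D v y → does (distinctIn? D (v ++ y ∷ [])) ≡ does (y ∈? D) ∧ does (distinctIn? (D ∖ y) v)
  distinctIn?-∷ʳ D v y =
    does-≡ (distinctIn? D (v ++ y ∷ [])) (Dec.map (DistinctIn-∷ʳ D v y) ((y ∈? D) ×-dec distinctIn? (D ∖ y) v))

  signedMajGF : List (Fin n) → Label n → Poly
  signedMajGF w c = ∑ (signings r w) (λ σ → qpow (majFollowedBy σ c))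

  permMajGF : ℕ → List (Fin n) → Label n → Poly
  permMajGF m D c = ∑ (words n m) (λ w → when (does (distinctIn? D w)) (signedMajGF w c))

  aboveGF : List (Fin n) → Label n → Poly
  aboveGF D c = ∑ (signings r D) (λ τ → qpow (countAbove (labels τ) c))

  lastDescent : Label n → ℕ → ℤ × Fin n → Poly
  lastDescent c m x = qpow (onlyIf (c <ᴸ label x) (suc m))

  signedMajGF-∷ʳ : ∀ v y c →
    signedMajGF (v ++ y ∷ []) c ≋ ∑ (Sset (r y)) (λ j → lastDescent c (length v) (j , y) *ᵖ signedMajGF v (lpair j y))
  signedMajGF-∷ʳ v y c = begin
    signedMajGF (v ++ y ∷ []) c
      ≈⟨ ∑-signings-∷ʳ v y (λ σ → qpow (majFollowedBy σ c)) ⟩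
    ∑ (signings r v) (λ τ → ∑ (Sset (r y)) (λ j → qpow (majFollowedBy (τ ++ (j , y) ∷ []) c)))
      ≈⟨ ∑-congᴬ (signings-letters v) (λ τ τ-letters → ∑-cong (Sset (r y)) (λ j → peel τ j τ-letters)) ⟩
    ∑ (signings r v) (λ τ → ∑ (Sset (r y)) (λ j → lastDescent c (length v) (j , y) *ᵖ qpow (majFollowedBy τ (lpair j y))))
      ≈⟨ ∑-comm _ (signings r v) (Sset (r y)) ⟩
    ∑ (Sset (r y)) (λ j → ∑ (signings r v) (λ τ → lastDescent c (length v) (j , y) *ᵖ qpow (majFollowedBy τ (lpair j y))))
      ≈⟨ ∑-cong (Sset (r y)) (λ j → *-∑ (lastDescent c (length v) (j , y)) _ (signings r v)) ⟨
    ∑ (Sset (r y)) (λ j → lastDescent c (length v) (j , y) *ᵖ signedMajGF v (lpair j y)) ∎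
    where
    open ≋-Reasoning
    peel : ∀ τ j → map proj₂ τ ≡ v →
           qpow (majFollowedBy (τ ++ (j , y) ∷ []) c) ≋ lastDescent c (length v) (j , y) *ᵖ qpow (majFollowedBy τ (lpair j y))
    peel τ j refl = ≋-trans (≡⇒≋ (cong qpow (majFollowedBy-∷ʳ τ (j , y) c)))
      (≋-trans (qpow-+ (onlyIf (c <ᴸ lpair j y) (suc (length τ))) _)
        (*ᵖ-congˡ (qpow (majFollowedBy τ (lpair j y)))
          (≡⇒≋ (cong (λ k → lastDescent c k (j , y)) (sym (length-map proj₂ τ))))))

  permMajGF-suc : ∀ m D c → permMajGF (suc m) D c ≋
    ∑ (allFin n) (λ y → when (does (y ∈? D))
      (∑ (Sset (r y)) (λ j → lastDescent c m (j , y) *ᵖ permMajGF m (D ∖ y) (lpair j y))))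
  permMajGF-suc m D c = begin
    permMajGF (suc m) D c
      ≈⟨ ∑-words-∷ʳ n m _ ⟩
    ∑ (words n m) (λ v → ∑ (allFin n) (λ y → when (does (distinctIn? D (v ++ y ∷ []))) (signedMajGF (v ++ y ∷ []) c)))
      ≈⟨ ∑-congᴬ (length-words n m) (λ v |v| → ∑-cong (allFin n) (lastLetter v |v|)) ⟩
    ∑ (words n m) (λ v → ∑ (allFin n) (λ y → when (does (y ∈? D)) (F y v)))
      ≈⟨ ∑-comm _ (words n m) (allFin n) ⟩
    ∑ (allFin n) (λ y → ∑ (words n m) (λ v → when (does (y ∈? D)) (F y v)))
      ≈⟨ ∑-cong (allFin n) (λ y → ≋-trans (∑-when (does (y ∈? D)) (F y) (words n m))
                                         (when-cong (does (y ∈? D)) (factor y))) ⟩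
    ∑ (allFin n) (λ y → when (does (y ∈? D))
      (∑ (Sset (r y)) (λ j → lastDescent c m (j , y) *ᵖ permMajGF m (D ∖ y) (lpair j y)))) ∎
    where
    open ≋-Reasoning
    F : Fin n → List (Fin n) → Poly
    F y v = when (does (distinctIn? (D ∖ y) v))
              (∑ (Sset (r y)) (λ j → lastDescent c m (j , y) *ᵖ signedMajGF v (lpair j y)))
    lastLetter : ∀ v → length v ≡ m → ∀ y →
      when (does (distinctIn? D (v ++ y ∷ []))) (signedMajGF (v ++ y ∷ []) c) ≋ when (does (y ∈? D)) (F y v)
    lastLetter v refl y rewrite distinctIn?-∷ʳ D v y
                              | when-∧ (does (y ∈? D)) (does (distinctIn? (D ∖ y) v)) (signedMajGF (v ++ y ∷ []) c) =
      when-cong (does (y ∈? D)) (when-cong (does (distinctIn? (D ∖ y) v)) (signedMajGF-∷ʳ v y c))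
    factor : ∀ y → ∑ (words n m) (F y) ≋ ∑ (Sset (r y)) (λ j → lastDescent c m (j , y) *ᵖ permMajGF m (D ∖ y) (lpair j y))
    factor y = begin
      ∑ (words n m) (F y)
        ≈⟨ ∑-cong (words n m) (λ v → ≋-trans (≋-sym (∑-when (b v) _ (Sset (r y))))
                                     (∑-cong (Sset (r y)) (λ j → ≋-sym (*-when (b v) (L j) _)))) ⟩
      ∑ (words n m) (λ v → ∑ (Sset (r y)) (λ j → L j *ᵖ when (b v) (signedMajGF v (lpair j y))))
        ≈⟨ ∑-comm _ (words n m) (Sset (r y)) ⟩
      ∑ (Sset (r y)) (λ j → ∑ (words n m) (λ v → L j *ᵖ when (b v) (signedMajGF v (lpair j y))))
        ≈⟨ ∑-cong (Sset (r y)) (λ j → *-∑ (L j) _ (words n m)) ⟨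
      ∑ (Sset (r y)) (λ j → L j *ᵖ permMajGF m (D ∖ y) (lpair j y)) ∎
      where
      b = λ v → does (distinctIn? (D ∖ y) v)
      L = λ j → lastDescent c m (j , y)

  signedSplitSum : (List (ℤ × Fin n) → ℤ × Fin n → List (ℤ × Fin n) → Poly) →
                   List (Fin n) → Fin n → List (Fin n) → Poly
  signedSplitSum G as y bs = ∑ (signings r as) (λ τ → ∑ (Sset (r y)) (λ j → ∑ (signings r bs) (G τ (j , y))))

  ∑-signings-∑splits : ∀ D (G : List (ℤ × Fin n) → ℤ × Fin n → List (ℤ × Fin n) → Poly) →
    ∑ (signings r D) (λ τ → ∑splits τ G) ≋ ∑splits D (signedSplitSum G)
  ∑-signings-∑splits []      G = ≋-refl
  ∑-signings-∑splits (d ∷ D) G = begin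
    ∑ (signings r (d ∷ D)) (λ τ → ∑splits τ G)
      ≈⟨ ∑-signings-∷ d D (λ τ → ∑splits τ G) ⟩
    ∑ S (λ j → ∑ σs (λ τ → G [] (j , d) τ +ᵖ ∑splits τ (G′ j)))
      ≈⟨ ∑-cong S (λ j → ∑-+ (G [] (j , d)) _ σs) ⟩
    ∑ S (λ j → first j +ᵖ rest j)
      ≈⟨ ∑-+ first rest S ⟩
    ∑ S first +ᵖ ∑ S rest
      ≈⟨ +ᵖ-cong (≋-sym (+ᵖ-identityʳ (∑ S first))) (∑-cong S (λ j → ∑-signings-∑splits D (G′ j))) ⟩
    signedSplitSum G [] d D +ᵖ ∑ S (λ j → ∑splits D (signedSplitSum (G′ j)))
      ≈⟨ +ᵖ-cong (≋-refl {signedSplitSum G [] d D}) (∑-∑splits S D (λ j → signedSplitSum (G′ j))) ⟩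
    signedSplitSum G [] d D +ᵖ ∑splits D (λ as y bs → ∑ S (λ j → signedSplitSum (G′ j) as y bs))
      ≈⟨ +ᵖ-cong (≋-refl {signedSplitSum G [] d D}) (∑splits-cong D (λ as y bs → ≋-sym (∑-signings-∷ d as _))) ⟩
    ∑splits (d ∷ D) (signedSplitSum G) ∎
    where
    open ≋-Reasoning
    S = Sset (r d)
    σs = signings r D
    G′ : ℤ → List (ℤ × Fin n) → ℤ × Fin n → List (ℤ × Fin n) → Poly
    G′ j as = G ((j , d) ∷ as)
    first rest : ℤ → Poly
    first j = ∑ σs (G [] (j , d))
    rest j = ∑ σs (λ τ → ∑splits τ (G′ j))

  -- Choosing y ∈ D, a sign for y and a signing of D ∖ y amounts to choosing a signing of D and one of its entries.
  ∑-signings-pick : ∀ D → Unique D → (Φ : ℤ × Fin n → List (ℤ × Fin n) → Poly) →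
    ∑ D (λ y → ∑ (Sset (r y)) (λ j → ∑ (signings r (D ∖ y)) (Φ (j , y)))) ≋
    ∑ (signings r D) (λ τ → ∑splits τ (λ as x bs → Φ x (as ++ bs)))
  ∑-signings-pick D unique Φ = begin
    ∑ D (λ y → ∑ (Sset (r y)) (λ j → ∑ (signings r (D ∖ y)) (Φ (j , y))))
      ≈⟨ ∑-∖ Poly-commutativeSemiring D unique (λ y L → ∑ (Sset (r y)) (λ j → ∑ (signings r L) (Φ (j , y)))) ⟩
    ∑splits D (λ as y bs → ∑ (Sset (r y)) (λ j → ∑ (signings r (as ++ bs)) (Φ (j , y))))
      ≈⟨ ∑splits-cong D (λ as y bs → ≋-trans (∑-cong (Sset (r y)) (λ j → ∑-signings-++ as bs (Φ (j , y))))
                                             (∑-comm _ (Sset (r y)) (signings r as))) ⟩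
    ∑splits D (signedSplitSum (λ τ x υ → Φ x (τ ++ υ)))
      ≈⟨ ∑-signings-∑splits D (λ as x bs → Φ x (as ++ bs)) ⟨
    ∑ (signings r D) (λ τ → ∑splits τ (λ as x bs → Φ x (as ++ bs))) ∎
    where open ≋-Reasoning

  Apart : Label n → List (Fin n) → Set
  Apart c D = ∀ {i} → i ∈ D → ∀ j → lpair j i # c

  labels-pairwise : ∀ τ → Unique (map proj₂ τ) → AllPairs _#_ (labels τ)
  labels-pairwise τ unique =
    AllPairs.map⁺ (AllPairs.map (λ {x} {y} → lpair-comparable (proj₁ x) (proj₁ y)) (AllPairs.map⁻ unique))

  labels-apart : ∀ τ {c} → Apart c (map proj₂ τ) → All (_# c) (labels τ)
  labels-apart τ apart = All.map⁺ (All.tabulate (λ {x} x∈τ → apart (∈-map⁺ proj₂ x∈τ) (proj₁ x)))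

  ∑splits-rankTerm : ∀ k c τ →
    ∑splits τ (λ as x bs → rankTerm k (labels (as ++ bs)) c (label x)) ≋ ∑ (labels τ) (rankTerm k (labels τ) c)
  ∑splits-rankTerm k c τ = begin
    ∑splits τ (λ as x bs → rankTerm k (labels (as ++ bs)) c (label x))
      ≈⟨ ∑splits-cong τ (λ as x bs → ≡⇒≋ (cong (λ e → qpow (onlyIf (c <ᴸ label x) k + e)) (removed as x bs))) ⟩
    ∑splits τ (λ as x bs → rankTerm k (labels (as ++ x ∷ bs)) c (label x))
      ≡⟨ ∑splits-whole τ (λ x σ → rankTerm k (labels σ) c (label x)) ⟩
    ∑ τ (λ x → rankTerm k (labels τ) c (label x))
      ≡⟨ ∑-map (rankTerm k (labels τ) c) label τ ⟨
    ∑ (labels τ) (rankTerm k (labels τ) c) ∎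
    where
    open ≋-Reasoning
    removed : ∀ as x bs → countAbove (labels (as ++ bs)) (label x) ≡ countAbove (labels (as ++ x ∷ bs)) (label x)
    removed as x bs rewrite map-++ label as bs | map-++ label as (x ∷ bs) =
      sym (countAbove-remove-self (labels as) (label x) (labels bs))

  lastEntryGF : Label n → ℕ → Fin n → List (Fin n) → Poly
  lastEntryGF c m y L = ∑ (Sset (r y)) (λ j → ∑ (signings r L) (λ τ → rankTerm (suc m) (labels τ) c (lpair j y)))

  lastEntryGF-factor : ∀ m L c y → (∀ j → permMajGF m L (lpair j y) ≋ qfact m *ᵖ aboveGF L (lpair j y)) →
    ∑ (Sset (r y)) (λ j → lastDescent c m (j , y) *ᵖ permMajGF m L (lpair j y)) ≋ qfact m *ᵖ lastEntryGF c m y L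
  lastEntryGF-factor m L c y IH = begin
    ∑ (Sset (r y)) (λ j → lastDescent c m (j , y) *ᵖ permMajGF m L (lpair j y))
      ≈⟨ ∑-cong (Sset (r y)) (λ j → *ᵖ-congʳ (lastDescent c m (j , y)) (IH j)) ⟩
    ∑ (Sset (r y)) (λ j → lastDescent c m (j , y) *ᵖ (qfact m *ᵖ aboveGF L (lpair j y)))
      ≈⟨ ∑-cong (Sset (r y)) (λ j → *ᵖ-exchange (lastDescent c m (j , y)) (qfact m) _) ⟩
    ∑ (Sset (r y)) (λ j → qfact m *ᵖ (lastDescent c m (j , y) *ᵖ aboveGF L (lpair j y)))
      ≈⟨ *-∑ (qfact m) _ (Sset (r y)) ⟨
    qfact m *ᵖ ∑ (Sset (r y)) (λ j → lastDescent c m (j , y) *ᵖ aboveGF L (lpair j y))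
      ≈⟨ *ᵖ-congʳ (qfact m) (∑-cong (Sset (r y)) (λ j → ≋-trans (*-∑ (lastDescent c m (j , y)) _ (signings r L))
           (∑-cong (signings r L) (λ τ → ≋-sym (qpow-+ _ (countAbove (labels τ) (lpair j y))))))) ⟩
    qfact m *ᵖ lastEntryGF c m y L ∎
    where open ≋-Reasoning

  ∑-signings-rank : ∀ m D c → length D ≡ suc m → Unique D → Apart c D →
    ∑ (signings r D) (λ τ → ∑splits τ (λ as x bs → rankTerm (suc m) (labels (as ++ bs)) c (label x)))
      ≋ qint (suc m) *ᵖ aboveGF D c
  ∑-signings-rank m D c |D| unique apart =
    ≋-trans (∑-congᴬ (signings-letters D) ranked) (≋-sym (*-∑ (qint (suc m)) _ (signings r D)))
    where
    ranked : ∀ τ → map proj₂ τ ≡ D → ∑splits τ (λ as x bs → rankTerm (suc m) (labels (as ++ bs)) c (label x))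
                                      ≋ qint (suc m) *ᵖ qpow (countAbove (labels τ) c)
    ranked τ refl = ≋-trans (∑splits-rankTerm (suc m) c τ)
      (rank (suc m) (labels τ) c (trans (length-map label τ) (trans (sym (length-map proj₂ τ)) |D|))
            (labels-pairwise τ unique) (labels-apart τ apart))

  permMajGF-factorises : ∀ m D c → length D ≡ m → Unique D → Apart c D →
    permMajGF m D c ≋ qfact m *ᵖ aboveGF D c
  permMajGF-factorises zero    []  c _   _      _     = ≋-sym (*ᵖ-identityˡ _)
  permMajGF-factorises (suc m) D c |D| unique apart = begin
    permMajGF (suc m) D c
      ≈⟨ permMajGF-suc m D c ⟩
    ∑ (allFin n) (λ y → when (does (y ∈? D))
      (∑ (Sset (r y)) (λ j → lastDescent c m (j , y) *ᵖ permMajGF m (D ∖ y) (lpair j y))))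
      ≈⟨ ∑-cong (allFin n) recurse ⟩
    ∑ (allFin n) (λ y → when (does (y ∈? D)) (qfact m *ᵖ lastEntryGF c m y (D ∖ y)))
      ≈⟨ ∑-when-∈ Poly-commutativeSemiring (allFin n) D (Unique.allFin⁺ n) unique (All.universal ∈-allFin D) _ ⟩
    ∑ D (λ y → qfact m *ᵖ lastEntryGF c m y (D ∖ y))
      ≈⟨ *-∑ (qfact m) _ D ⟨
    qfact m *ᵖ ∑ D (λ y → lastEntryGF c m y (D ∖ y))
      ≈⟨ *ᵖ-congʳ (qfact m) (∑-signings-pick D unique (λ x τ → rankTerm (suc m) (labels τ) c (label x))) ⟩
    qfact m *ᵖ ∑ (signings r D) (λ τ → ∑splits τ (λ as x bs → rankTerm (suc m) (labels (as ++ bs)) c (label x)))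
      ≈⟨ *ᵖ-congʳ (qfact m) (∑-signings-rank m D c |D| unique apart) ⟩
    qfact m *ᵖ (qint (suc m) *ᵖ aboveGF D c)
      ≈⟨ *ᵖ-exchange (qfact m) (qint (suc m)) _ ⟩
    qint (suc m) *ᵖ (qfact m *ᵖ aboveGF D c)
      ≈⟨ *ᵖ-assoc (qint (suc m)) (qfact m) _ ⟨
    qfact (suc m) *ᵖ aboveGF D c ∎
    where
    open ≋-Reasoning
    recurse : ∀ y →
      when (does (y ∈? D)) (∑ (Sset (r y)) (λ j → lastDescent c m (j , y) *ᵖ permMajGF m (D ∖ y) (lpair j y)))
        ≋ when (does (y ∈? D)) (qfact m *ᵖ lastEntryGF c m y (D ∖ y))
    recurse y with y ∈? D
    ... | no _    = ≋-refl
    ... | yes y∈D = lastEntryGF-factor m (D ∖ y) c y λ j →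
      permMajGF-factorises m (D ∖ y) (lpair j y) (suc-injective (trans (sym (length-∖ D unique y∈D)) |D|))
        (∖-unique y unique) (λ i∈D∖y j′ → lpair-comparable j′ j (proj₂ (∈-∖⁻ D i∈D∖y)))

  maj≡majFollowedBy-lzero : ∀ σ → maj σ ≡ majFollowedBy σ lzero
  maj≡majFollowedBy-lzero σ = cong (majFrom 1) (fullWord≡ σ)
    where
    fullWord≡ : ∀ σ → fullWord σ ≡ labels σ ++ lzero ∷ []
    fullWord≡ []            = refl
    fullWord≡ ((j , i) ∷ σ) = cong (lpair j i ∷_) (fullWord≡ σ)

  signedPerms-majGF : sumᵖ (map (λ σ → qpow (maj σ)) (signedPerms n r)) ≋ permMajGF n (allFin n) lzero
  signedPerms-majGF = begin
    sumᵖ (map (λ σ → qpow (maj σ)) (signedPerms n r))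
      ≡⟨ sumᵖ-map (λ σ → qpow (maj σ)) (signedPerms n r) ⟩
    ∑ (concatMap (signings r) (perms n)) (λ σ → qpow (maj σ))
      ≈⟨ ∑-concatMap _ (signings r) (perms n) ⟩
    ∑ (perms n) (λ w → ∑ (signings r w) (λ σ → qpow (maj σ)))
      ≈⟨ ∑-cong (perms n) (λ w → ∑-cong (signings r w) (λ σ → ≡⇒≋ (cong qpow (maj≡majFollowedBy-lzero σ)))) ⟩
    ∑ (perms n) (λ w → signedMajGF w lzero)
      ≈⟨ ∑-filter (unique? Fin._≟_) _ (words n n) ⟩
    ∑ (words n n) (λ w → when (does (unique? Fin._≟_ w)) (signedMajGF w lzero))
      ≈⟨ ∑-cong (words n n) (λ w → ≡⇒≋ (cong (λ b → when b (signedMajGF w lzero)) (all-in-allFin w))) ⟩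
    permMajGF n (allFin n) lzero ∎
    where
    open ≋-Reasoning
    all-in-allFin : ∀ w → does (unique? Fin._≟_ w) ≡ does (distinctIn? (allFin n) w)
    all-in-allFin w = sym (trans
      (cong (does (unique? Fin._≟_ w) ∧_) (dec-true (All.all? (_∈? allFin n) w) (All.universal ∈-allFin w)))
      (∧-identityʳ _))

  ∑-Sset-sign : ∀ k (d : Fin n) → ∑ (Sset k) (λ j → qpow (onlyIf (lzero <ᴸ lpair j d) 1)) ≋ 1 ∷ (k ∸ 1) ∷ []
  ∑-Sset-sign k d = +ᵖ-cong (≋-refl {1ᵖ}) (begin
    ∑ (map (λ t → ℤ.+ (2 + t)) (upTo (k ∸ 1))) (λ j → qpow (onlyIf (lzero <ᴸ lpair j d) 1))
      ≡⟨ ∑-map (λ j → qpow (onlyIf (lzero <ᴸ lpair j d) 1)) (λ t → ℤ.+ (2 + t)) (upTo (k ∸ 1)) ⟩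
    ∑ (upTo (k ∸ 1)) (λ _ → qpow 1)
      ≈⟨ ∑-const-q (upTo (k ∸ 1)) ⟩
    0 ∷ length (upTo (k ∸ 1)) ∷ []
      ≡⟨ cong (λ l → 0 ∷ l ∷ []) (length-upTo (k ∸ 1)) ⟩
    0 ∷ (k ∸ 1) ∷ [] ∎)
    where open ≋-Reasoning

  aboveGF-lzero : ∀ D → aboveGF D lzero ≋ prodᵖ (map (λ i → 1 ∷ (r i ∸ 1) ∷ []) D)
  aboveGF-lzero []      = ≋-refl
  aboveGF-lzero (d ∷ D) = begin
    aboveGF (d ∷ D) lzero
      ≈⟨ ∑-signings-∷ d D (λ τ → qpow (countAbove (labels τ) lzero)) ⟩
    ∑ (Sset (r d)) (λ j → ∑ (signings r D) (λ τ → qpow (sign j + countAbove (labels τ) lzero)))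
      ≈⟨ ∑-cong (Sset (r d)) (λ j → ∑-cong (signings r D) (λ τ → qpow-+ (sign j) _)) ⟩
    ∑ (Sset (r d)) (λ j → ∑ (signings r D) (λ τ → qpow (sign j) *ᵖ qpow (countAbove (labels τ) lzero)))
      ≈⟨ ∑-cong (Sset (r d)) (λ j → *-∑ (qpow (sign j)) _ (signings r D)) ⟨
    ∑ (Sset (r d)) (λ j → qpow (sign j) *ᵖ aboveGF D lzero)
      ≈⟨ ∑-* (λ j → qpow (sign j)) (Sset (r d)) (aboveGF D lzero) ⟨
    ∑ (Sset (r d)) (λ j → qpow (sign j)) *ᵖ aboveGF D lzero
      ≈⟨ *ᵖ-cong (∑-Sset-sign (r d) d) (aboveGF-lzero D) ⟩
    (1 ∷ (r d ∸ 1) ∷ []) *ᵖ prodᵖ (map (λ i → 1 ∷ (r i ∸ 1) ∷ []) D) ∎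
    where
    open ≋-Reasoning
    sign : ℤ → ℕ
    sign j = onlyIf (lzero <ᴸ lpair j d) 1

mainTheorem9 : (n : ℕ) (r : Fin n → ℕ) → (∀ i → 1 ≤ r i) →
    sumᵖ (map (λ σ → qpow (maj σ)) (signedPerms n r))
    ≈ᵖ (qfact n *ᵖ prodᵖ (map (λ i → 1 ∷ (r i ∸ 1) ∷ []) (allFin n)))
mainTheorem9 n r _ = coeff-≡ (begin
  sumᵖ (map (λ σ → qpow (maj σ)) (signedPerms n r))
    ≈⟨ signedPerms-majGF ⟩
  permMajGF n (allFin n) lzero
    ≈⟨ permMajGF-factorises n (allFin n) lzero (length-tabulate (λ i → i)) (Unique.allFin⁺ n)
                            (λ {i} _ j → lpair-comparable-lzero j i) ⟩
  qfact n *ᵖ aboveGF (allFin n) lzero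
    ≈⟨ *ᵖ-congʳ (qfact n) (aboveGF-lzero (allFin n)) ⟩
  qfact n *ᵖ prodᵖ (map (λ i → 1 ∷ (r i ∸ 1) ∷ []) (allFin n)) ∎)
  where
  open SignedPermutations n r
  open ≋-Reasoning
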